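{- Let $m\geq1$ and let $\mathbf{m}=m(m-1)\cdots21$ be the decreasing permutation of length $m$. Then $$F_{\mathbf m}(x,q)=\frac{U_{m-2}(t)-\sqrt x\,U_{m-3}(t)}{\sqrt x\,\big(U_{m-1}(t)-\sqrt x\,U_{m-2}(t)\big)},\qquad t=\frac{1+x-xq}{2\sqrt x}.$$
   Context: For $\tau\in S_k(312)$, $F_\tau(x,q)=\sum_{n\geq0}\sum_{\sigma\in S_n(312,\tau)}x^nq^{L_n(\sigma)}$, where $S_n(312,\tau)$ is the set of permutations of $[n]$ avoiding the patterns $312$ and $\tau$ (the empty permutation counted for $n=0$), and $L_n(\sigma)$ is the length of a longest increasing subsequence ($0$ for the empty permutation). $U_j$ are the Chebyshev polynomials of the second kind, $U_j(\cos\theta)=\sin((j+1)\theta)/\sin\theta$, extended to all integers $j$ by $U_0(t)=1$, $U_1(t)=2t$, $U_j(t)=2tU_{j-1}(t)-U_{j-2}(t)$ for all integers $j$ (so $U_{ -1}=0$, $U_{ -2}=-1$). -}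

module Defs where

open import Data.Bool using (Bool; true; false; _∧_; not; if_then_else_)
open import Data.Nat as ℕ using (ℕ; zero; suc; _∸_; _<ᵇ_; _≡ᵇ_; _⊔_)
open import Data.Integer as ℤ using (ℤ; +_)
open import Data.List using (List; []; _∷_; [_]; map; _++_; concatMap; filter; length; zip; foldr)
open import Data.Bool.ListAction using (all; any)
open import Data.Product using (_×_; _,_)
open import Relation.Nullary.Decidable using (does)
open import Relation.Binary.PropositionalEquality using (_≡_)
open import Data.Bool.Properties using () renaming (_≟_ to _≟𝔹_)

-- A permutation σ of [n] = {1,…,n} is the list σ(1) σ(2) … σ(n).

insertAll : ℕ → List ℕ → List (List ℕ)
insertAll v []       = [ v ∷ [] ]
insertAll v (y ∷ ys) = (v ∷ y ∷ ys) ∷ map (y ∷_) (insertAll v ys)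

perms : ℕ → List (List ℕ)
perms zero    = [ [] ]
perms (suc n) = concatMap (insertAll (suc n)) (perms n)

subseqs : List ℕ → List (List ℕ)
subseqs []       = [ [] ]
subseqs (y ∷ ys) = map (y ∷_) (subseqs ys) ++ subseqs ys

orderIso : List ℕ → List ℕ → Bool
orderIso u v =
  (length u ≡ᵇ length v) ∧
  all (λ { (a , b) → all (λ { (c , d) → does ((a <ᵇ c) ≟𝔹 (b <ᵇ d)) }) (zip u v) }) (zip u v)

contains : List ℕ → List ℕ → Bool
contains σ τ = any (λ u → orderIso u τ) (subseqs σ)

avoids : List ℕ → List ℕ → Bool
avoids σ τ = not (contains σ τ)

increasing : List ℕ → Bool
increasing []           = true
increasing (a ∷ [])     = true
increasing (a ∷ b ∷ bs) = (a <ᵇ b) ∧ increasing (b ∷ bs)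

lis : List ℕ → ℕ
lis σ = foldr _⊔_ 0 (map length (filter (λ u → increasing u ≟𝔹 true) (subseqs σ)))

p312 : List ℕ
p312 = 3 ∷ 1 ∷ 2 ∷ []

decreasing : ℕ → List ℕ
decreasing zero    = []
decreasing (suc m) = suc m ∷ decreasing m

-- Formal power series in x and q with integer coefficients:
-- S n ℓ is the coefficient of x^n q^ℓ.

Series : Set
Series = ℕ → ℕ → ℤ

sumTo : ℕ → (ℕ → ℤ) → ℤ
sumTo zero    f = f zero
sumTo (suc n) f = sumTo n f ℤ.+ f (suc n)

infixl 6 _⊕_ _⊖_
infixl 7 _⊛_

_⊕_ : Series → Series → Series
(A ⊕ B) n ℓ = A n ℓ ℤ.+ B n ℓ

_⊖_ : Series → Series → Series
(A ⊖ B) n ℓ = A n ℓ ℤ.- B n ℓ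

_⊛_ : Series → Series → Series
(A ⊛ B) n ℓ = sumTo n (λ i → sumTo ℓ (λ j → A i j ℤ.* B (n ∸ i) (ℓ ∸ j)))

mono : ℕ → ℕ → Series
mono a b n ℓ = if (a ≡ᵇ n) ∧ (b ≡ᵇ ℓ) then ℤ.1ℤ else ℤ.0ℤ

𝟙 X Q : Series
𝟙 = mono 0 0
X = mono 1 0
Q = mono 0 1

F : List ℕ → Series
F τ n ℓ = + length (filter (λ σ → (avoids σ p312 ∧ avoids σ τ ∧ (lis σ ≡ᵇ ℓ)) ≟𝔹 true) (perms n))

-- With s = √x and t = (1+x-xq)/(2s), put V_j = s^j U_j(t).  Then
--   V_j = (1+x-xq) V_{j-1} - x V_{j-2},  V_{-1} = 0,  V_{-2} = -1/x.
-- Y_j := x V_j is a polynomial for all j ≥ -2, and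
--   Chebyshev k := Y_{k-2} = x (√x)^{k-2} U_{k-2}(t)   (k ∈ ℕ).

Chebyshev : ℕ → Series
Chebyshev zero          n ℓ = ℤ.- 𝟙 n ℓ               -- Y_{-2} = x·(1/x)·U_{-2} = -1
Chebyshev (suc zero)    n ℓ = ℤ.0ℤ                    -- Y_{-1} = x·V_{-1} = 0
Chebyshev (suc (suc k)) =
  (𝟙 ⊕ X ⊖ X ⊛ Q) ⊛ Chebyshev (suc k) ⊖ X ⊛ Chebyshev k

-- A 312-avoiding permutation of [n+1] is obtained from a unique 312-avoider π of [n] by
-- inserting n+1 in front of the last k entries of π, where k is at most the length r of
-- the final decreasing run of π.  The result has final run k+1, avoids m⋯21 iff π does
-- and k+1 < m, and its longest increasing subsequence is that of π plus one, except
-- when k = r ≥ 1.  So the generating functions G_r of the permutations in F_m with final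
-- run r satisfy G_0 = 1, G_1 = xq Σ_s G_s and G_(k+2) = xq Σ_(s≥k+2) G_s + x G_(k+1).
-- An induction along the Chebyshev recurrence then gives F_m · D_(k+1) = x Σ_(s≥k+1) G_s + D_k,
-- and for k = m - 1 the sum is empty.

module Submission where

open import Defs
open import Data.Bool using (Bool; true; false; _∧_; not; if_then_else_; T)
open import Data.Bool.Properties using (T-≡; ∧-zeroʳ; ∧-identityʳ; ∧-assoc; not-¬; ¬-not) renaming (_≟_ to _≟𝔹_)
open import Data.Bool.ListAction using (all)
open import Data.Nat using (ℕ; zero; suc; _+_; _∸_; _<ᵇ_; _≡ᵇ_; _≤ᵇ_; _⊔_; _≤_; _<_; z≤n; s≤s)
open import Data.Nat.Properties
open import Data.List using (List; []; _∷_; [_]; map; _++_; concatMap; filter; length; zip; foldr; take)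
open import Data.List.Properties using (length-++; length-take; ++-identityʳ; ∷-injective)
open import Data.List.Membership.Propositional using (_∈_; find; lose)
open import Data.List.Membership.Propositional.Properties
  using (∈-map⁺; ∈-map⁻; ∈-++⁺ˡ; ∈-++⁺ʳ; ∈-++⁻; ∈-filter⁺; ∈-filter⁻)
open import Data.List.Relation.Unary.All using (All; []; _∷_)
import Data.List.Relation.Unary.All as All
import Data.List.Relation.Unary.All.Properties as All
open import Data.List.Relation.Unary.Any using (here; there)
open import Data.List.Relation.Unary.Any.Properties using (any⁺; any⁻)
open import Data.List.Relation.Unary.AllPairs using ([]; _∷_)
open import Data.List.Relation.Unary.Unique.Propositional using (Unique)
open import Data.List.Relation.Binary.Sublist.Propositional using (_⊆_; []; _∷_; _∷ʳ_; ⊆-refl; ⊆-trans; minimum)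
import Data.List.Relation.Binary.Sublist.Propositional.Properties as Sublist
open import Data.Product using (∃; ∃₂; _×_; _,_; proj₁; proj₂)
open import Data.Sum using (_⊎_; inj₁; inj₂)
open import Data.Empty using (⊥; ⊥-elim)
open import Function using (_∘_; Equivalence)
open import Relation.Nullary using (Dec)
open import Relation.Nullary.Decidable using (does)
open import Relation.Binary.PropositionalEquality hiding ([_])
open import Relation.Binary.Definitions using (tri<; tri≈; tri>)
open import Relation.Binary.Bundles using (Setoid)
open import Level using (0ℓ)
import Relation.Binary.Reasoning.Setoid as SetoidReasoning
open import Data.Integer as ℤ using (ℤ; 0ℤ; 1ℤ)
import Data.Integer.Properties as ℤ
open import Data.Integer.Tactic.RingSolver using (solve-∀)
import Algebra.Properties.CommutativeSemigroup as CommutativeSemigroupProperties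

module ℕ+ = CommutativeSemigroupProperties +-commutativeSemigroup
module ℤ+ = CommutativeSemigroupProperties ℤ.+-commutativeSemigroup

∧-true⁻ : ∀ {x y} → x ∧ y ≡ true → x ≡ true × y ≡ true
∧-true⁻ {true} h = refl , h

∧-true⁺ : ∀ {x y} → x ≡ true → y ≡ true → x ∧ y ≡ true
∧-true⁺ refl refl = refl

≡-from-⇔ : ∀ {x y} → (x ≡ true → y ≡ true) → (y ≡ true → x ≡ true) → x ≡ y
≡-from-⇔ {false} {false} _ _ = refl
≡-from-⇔ {false} {true} _ g = g refl
≡-from-⇔ {true} {false} f _ = sym (f refl)
≡-from-⇔ {true} {true} _ _ = refl

true-from-T : ∀ {x} → T x → x ≡ true
true-from-T = Equivalence.to T-≡

T-from-true : ∀ {x} → x ≡ true → T x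
T-from-true = Equivalence.from T-≡

does≟true : ∀ x → does (x ≟𝔹 true) ≡ x
does≟true true = refl
does≟true false = refl

does≟false : ∀ x → does (x ≟𝔹 false) ≡ not x
does≟false true = refl
does≟false false = refl

<ᵇ-true : ∀ {m n} → m < n → (m <ᵇ n) ≡ true
<ᵇ-true = true-from-T ∘ <⇒<ᵇ

<ᵇ-true⁻ : ∀ {m n} → (m <ᵇ n) ≡ true → m < n
<ᵇ-true⁻ {m} {n} = <ᵇ⇒< m n ∘ T-from-true

<ᵇ-false : ∀ {m n} → n ≤ m → (m <ᵇ n) ≡ false
<ᵇ-false {m} {zero} _ = refl
<ᵇ-false {suc m} {suc n} (s≤s h) = <ᵇ-false h

<ᵇ-false⁻ : ∀ {m n} → (m <ᵇ n) ≡ false → n ≤ m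
<ᵇ-false⁻ {m} {n} h = ≮⇒≥ (λ m<n → subst T h (<⇒<ᵇ m<n))

≤ᵇ-true : ∀ {m n} → m ≤ n → (m ≤ᵇ n) ≡ true
≤ᵇ-true = true-from-T ∘ ≤⇒≤ᵇ

≤ᵇ-true⁻ : ∀ {m n} → (m ≤ᵇ n) ≡ true → m ≤ n
≤ᵇ-true⁻ {m} {n} = ≤ᵇ⇒≤ m n ∘ T-from-true

≤ᵇ-false : ∀ {m n} → n < m → (m ≤ᵇ n) ≡ false
≤ᵇ-false {suc m} (s≤s h) = <ᵇ-false h

≡ᵇ-true⁻ : ∀ {m n} → (m ≡ᵇ n) ≡ true → m ≡ n
≡ᵇ-true⁻ {m} {n} = ≡ᵇ⇒≡ m n ∘ T-from-true

≡ᵇ-refl : ∀ m → (m ≡ᵇ m) ≡ true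
≡ᵇ-refl m = true-from-T (≡⇒≡ᵇ m m refl)

≡ᵇ-false : ∀ {m n} → m ≢ n → (m ≡ᵇ n) ≡ false
≡ᵇ-false {m} {n} m≢n with m ≡ᵇ n in e
... | true = ⊥-elim (m≢n (≡ᵇ-true⁻ e))
... | false = refl

⊆-++⁻ : ∀ {A : Set} {u : List A} xs {ys} → u ⊆ xs ++ ys →
        ∃₂ λ (u₁ u₂ : List A) → u ≡ u₁ ++ u₂ × u₁ ⊆ xs × u₂ ⊆ ys
⊆-++⁻ [] {ys} s = [] , _ , refl , minimum [] , s
⊆-++⁻ (x ∷ xs) (.x ∷ʳ s) with ⊆-++⁻ xs s
... | u₁ , u₂ , refl , s₁ , s₂ = u₁ , u₂ , refl , x ∷ʳ s₁ , s₂
⊆-++⁻ (x ∷ xs) (refl ∷ s) with ⊆-++⁻ xs s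
... | u₁ , u₂ , refl , s₁ , s₂ = x ∷ u₁ , u₂ , refl , refl ∷ s₁ , s₂

delete-⊆ : ∀ {A : Set} xs (v : A) ys → xs ++ ys ⊆ xs ++ v ∷ ys
delete-⊆ xs v ys = Sublist.++⁺ ⊆-refl (v ∷ʳ ⊆-refl)

++-suffix : ∀ {A : Set} (xs ys as bs : List A) → xs ++ ys ≡ as ++ bs → length bs ≤ length ys →
            ∃ λ cs → as ≡ xs ++ cs × ys ≡ cs ++ bs
++-suffix [] ys as bs eq _ = as , refl , eq
++-suffix (x ∷ xs) ys [] bs refl bs≤ys =
  ⊥-elim (<-irrefl refl (≤-trans bs≤ys (≤-trans (m≤n+m (length ys) (length xs)) (≤-reflexive (sym (length-++ xs))))))
++-suffix (x ∷ xs) ys (a ∷ as) bs eq bs≤ys with ∷-injective eq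
... | refl , eq′ with ++-suffix xs ys as bs eq′ bs≤ys
...   | cs , refl , ys≡ = cs , refl , ys≡

All-insert : ∀ {A : Set} {P : A → Set} {v} xs ys → All P (xs ++ ys) → P v → All P (xs ++ v ∷ ys)
All-insert xs ys h pv = All.++⁺ (All.++⁻ˡ xs h) (pv ∷ All.++⁻ʳ xs h)

Unique-insert : ∀ {v} xs ys → All (_< v) (xs ++ ys) → Unique (xs ++ ys) → Unique (xs ++ v ∷ ys)
Unique-insert [] ys below unique = All.map (λ a<v v≡a → <-irrefl (sym v≡a) a<v) below ∷ unique
Unique-insert (x ∷ xs) ys (x<v ∷ below) (x≢ ∷ unique) =
  All-insert xs ys x≢ (<⇒≢ x<v) ∷ Unique-insert xs ys below unique

Unique-++⁻ʳ : ∀ {A : Set} xs {ys : List A} → Unique (xs ++ ys) → Unique ys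
Unique-++⁻ʳ [] unique = unique
Unique-++⁻ʳ (x ∷ xs) (_ ∷ unique) = Unique-++⁻ʳ xs unique

foldr-⊔-upper : ∀ {x xs} → x ∈ xs → x ≤ foldr _⊔_ 0 xs
foldr-⊔-upper {x} (here refl) = m≤m⊔n x _
foldr-⊔-upper {xs = y ∷ _} (there x∈) = ≤-trans (foldr-⊔-upper x∈) (m≤n⊔m y _)

foldr-⊔-attained : ∀ xs → foldr _⊔_ 0 xs ≡ 0 ⊎ foldr _⊔_ 0 xs ∈ xs
foldr-⊔-attained [] = inj₁ refl
foldr-⊔-attained (x ∷ xs) with ⊔-sel x (foldr _⊔_ 0 xs)
... | inj₁ ≡x = inj₂ (here ≡x)
... | inj₂ ≡rest with foldr-⊔-attained xs
...   | inj₁ ≡0 = inj₁ (trans ≡rest ≡0)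
...   | inj₂ ∈xs = inj₂ (there (subst (_∈ xs) (sym ≡rest) ∈xs))

indicator : Bool → ℕ
indicator b = if b then 1 else 0

indicator-∧ : ∀ b {c} → (b ≡ true → c ≡ true) → indicator (b ∧ c) ≡ indicator b
indicator-∧ false _ = refl
indicator-∧ true h rewrite h refl = refl

count : {A : Set} → (A → Bool) → List A → ℕ
count p [] = 0
count p (x ∷ xs) = indicator (p x) + count p xs

length-filter≡count : ∀ {A : Set} (p : A → Bool) xs → length (filter (λ x → p x ≟𝔹 true) xs) ≡ count p xs
length-filter≡count p [] = refl
length-filter≡count p (x ∷ xs) with p x
... | true = cong suc (length-filter≡count p xs)
... | false = length-filter≡count p xs

count-cong : ∀ {A : Set} {p q : A → Bool} {xs} → All (λ x → p x ≡ q x) xs → count p xs ≡ count q xs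
count-cong [] = refl
count-cong (px≡qx ∷ h) = cong₂ _+_ (cong indicator px≡qx) (count-cong h)

count-ext : ∀ {A : Set} {p q : A → Bool} → (∀ x → p x ≡ q x) → ∀ xs → count p xs ≡ count q xs
count-ext p≡q xs = count-cong (All.universal p≡q xs)

count-zero : ∀ {A : Set} {p : A → Bool} {xs} → All (λ x → p x ≡ false) xs → count p xs ≡ 0
count-zero [] = refl
count-zero (px≡false ∷ h) rewrite px≡false = count-zero h

count-+ : ∀ {A : Set} {p : A → Bool} (q r : A → Bool) xs → (∀ x → indicator (p x) ≡ indicator (q x) + indicator (r x)) →
  count p xs ≡ count q xs + count r xs
count-+ q r [] _ = refl
count-+ q r (x ∷ xs) h rewrite h x | count-+ q r xs h =
  ℕ+.interchange (indicator (q x)) (indicator (r x)) (count q xs) (count r xs)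

count-++ : ∀ {A : Set} (p : A → Bool) xs ys → count p (xs ++ ys) ≡ count p xs + count p ys
count-++ p [] ys = refl
count-++ p (x ∷ xs) ys rewrite count-++ p xs ys = sym (+-assoc (indicator (p x)) _ _)

count-map : ∀ {A B : Set} (p : B → Bool) (f : A → B) xs → count p (map f xs) ≡ count (p ∘ f) xs
count-map p f [] = refl
count-map p f (x ∷ xs) = cong (indicator (p (f x)) +_) (count-map p f xs)

count-concatMap : ∀ {A B : Set} (p : B → Bool) (f : A → List B) (q : A → Bool) {xs} →
  All (λ x → count p (f x) ≡ indicator (q x)) xs → count p (concatMap f xs) ≡ count q xs
count-concatMap p f q [] = refl
count-concatMap p f q {x ∷ xs} (fx ∷ h) =
  trans (count-++ p (f x) (concatMap f xs)) (cong₂ _+_ fx (count-concatMap p f q h))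

∈-subseqs⁺ : ∀ {u σ} → u ⊆ σ → u ∈ subseqs σ
∈-subseqs⁺ [] = here refl
∈-subseqs⁺ {σ = y ∷ ys} (.y ∷ʳ s) = ∈-++⁺ʳ (map (y ∷_) (subseqs ys)) (∈-subseqs⁺ s)
∈-subseqs⁺ (refl ∷ s) = ∈-++⁺ˡ (∈-map⁺ _ (∈-subseqs⁺ s))

∈-subseqs⁻ : ∀ {u} σ → u ∈ subseqs σ → u ⊆ σ
∈-subseqs⁻ [] (here refl) = []
∈-subseqs⁻ (y ∷ ys) u∈ with ∈-++⁻ (map (y ∷_) (subseqs ys)) u∈
... | inj₂ u∈ys = y ∷ʳ ∈-subseqs⁻ ys u∈ys
... | inj₁ u∈y∷ys with ∈-map⁻ (y ∷_) u∈y∷ys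
...   | w , w∈ys , refl = refl ∷ ∈-subseqs⁻ ys w∈ys

contains⁻ : ∀ σ τ → contains σ τ ≡ true → ∃ λ u → u ⊆ σ × orderIso u τ ≡ true
contains⁻ σ τ h with find (any⁻ _ (subseqs σ) (T-from-true h))
... | u , u∈ , iso = u , ∈-subseqs⁻ σ u∈ , true-from-T iso

contains⁺ : ∀ {u σ} τ → u ⊆ σ → orderIso u τ ≡ true → contains σ τ ≡ true
contains⁺ τ s iso = true-from-T (any⁺ _ (lose (∈-subseqs⁺ s) (T-from-true iso)))

contains-⊆ : ∀ {σ σ′} τ → σ ⊆ σ′ → contains σ τ ≡ true → contains σ′ τ ≡ true
contains-⊆ {σ} τ s h with contains⁻ σ τ h
... | u , u⊆σ , iso = contains⁺ τ (⊆-trans u⊆σ s) iso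

avoids⁺ : ∀ σ τ → (contains σ τ ≡ true → ⊥) → avoids σ τ ≡ true
avoids⁺ σ τ h = cong not (¬-not h)

avoids⁻ : ∀ σ τ → avoids σ τ ≡ true → contains σ τ ≡ true → ⊥
avoids⁻ σ τ a c = not-¬ (sym c) (sym a)

isDecreasing : List ℕ → Bool
isDecreasing [] = true
isDecreasing (x ∷ u) = all (_<ᵇ x) u ∧ isDecreasing u

private
  agree : ℕ × ℕ → ℕ × ℕ → Bool
  agree p q = does ((proj₁ p <ᵇ proj₁ q) ≟𝔹 (proj₂ p <ᵇ proj₂ q))

  allAgree : List (ℕ × ℕ) → Bool
  allAgree P = all (λ p → all (agree p) P) P

  all-∧ : ∀ {A : Set} (f g : A → Bool) xs → all (λ a → f a ∧ g a) xs ≡ all f xs ∧ all g xs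
  all-∧ f g [] = refl
  all-∧ f g (x ∷ xs) with f x | g x
  ... | true | true = all-∧ f g xs
  ... | true | false = sym (∧-zeroʳ (all f xs))
  ... | false | _ = refl

  length-decreasing : ∀ m → length (decreasing m) ≡ m
  length-decreasing zero = refl
  length-decreasing (suc m) = cong suc (length-decreasing m)

  agree-top-row : ∀ x K u → length u ≤ K →
    all (agree (x , suc K)) (zip u (decreasing (length u))) ≡ all (λ c → not (x <ᵇ c)) u
  agree-top-row x K [] _ = refl
  agree-top-row x K (c ∷ u) le
    rewrite <ᵇ-false {suc K} {suc (length u)} (m≤n⇒m≤1+n le) | does≟false (x <ᵇ c)
    = cong (not (x <ᵇ c) ∧_) (agree-top-row x K u (≤-trans (n≤1+n _) le))

  agree-top-column : ∀ x K u → length u ≤ K →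
    all (λ q → agree q (x , suc K)) (zip u (decreasing (length u))) ≡ all (_<ᵇ x) u
  agree-top-column x K [] _ = refl
  agree-top-column x K (c ∷ u) le
    rewrite <ᵇ-true {suc (length u)} {suc K} (s≤s le) | does≟true (c <ᵇ x)
    = cong ((c <ᵇ x) ∧_) (agree-top-column x K u (≤-trans (n≤1+n _) le))

  all-<ᵇ⇒all-≮ᵇ : ∀ x u → all (_<ᵇ x) u ≡ true → all (λ c → not (x <ᵇ c)) u ≡ true
  all-<ᵇ⇒all-≮ᵇ x [] _ = refl
  all-<ᵇ⇒all-≮ᵇ x (c ∷ u) h with ∧-true⁻ {c <ᵇ x} h
  ... | c<x , rest rewrite <ᵇ-false {x} {c} (<⇒≤ (<ᵇ-true⁻ c<x)) = all-<ᵇ⇒all-≮ᵇ x u rest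

  allAgree-decreasing : ∀ u → allAgree (zip u (decreasing (length u))) ≡ isDecreasing u
  allAgree-decreasing [] = refl
  allAgree-decreasing (x ∷ u)
    rewrite <ᵇ-false {x} ≤-refl | <ᵇ-false {suc (length u)} ≤-refl
          | all-∧ (λ q → agree q (x , suc (length u))) (λ q → all (agree q) (zip u (decreasing (length u))))
                  (zip u (decreasing (length u)))
          | agree-top-row x (length u) u ≤-refl
          | agree-top-column x (length u) u ≤-refl
          | allAgree-decreasing u
    with all (_<ᵇ x) u in below
  ... | true rewrite all-<ᵇ⇒all-≮ᵇ x u below = refl
  ... | false = ∧-zeroʳ _

orderIso-decreasing⁻ : ∀ u m → orderIso u (decreasing m) ≡ true → length u ≡ m × isDecreasing u ≡ true
orderIso-decreasing⁻ u m h with ∧-true⁻ {length u ≡ᵇ length (decreasing m)} h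
... | same-length , agreeing =
  u≡m , trans (sym (allAgree-decreasing u)) (subst (λ k → allAgree (zip u (decreasing k)) ≡ true) (sym u≡m) agreeing)
  where
  u≡m : length u ≡ m
  u≡m = trans (≡ᵇ-true⁻ same-length) (length-decreasing m)

orderIso-decreasing⁺ : ∀ u → isDecreasing u ≡ true → orderIso u (decreasing (length u)) ≡ true
orderIso-decreasing⁺ u h rewrite length-decreasing (length u) | ≡ᵇ-refl (length u) = trans (allAgree-decreasing u) h

orderIso-312⁺ : ∀ {a b c} → b < c → c < a → orderIso (a ∷ b ∷ c ∷ []) p312 ≡ true
orderIso-312⁺ {a} {b} {c} b<c c<a
  rewrite <ᵇ-false {a} ≤-refl | <ᵇ-false {b} ≤-refl | <ᵇ-false {c} ≤-refl
        | <ᵇ-true b<c | <ᵇ-true c<a | <ᵇ-true (<-trans b<c c<a)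
        | <ᵇ-false (<⇒≤ b<c) | <ᵇ-false (<⇒≤ c<a) | <ᵇ-false (<⇒≤ (<-trans b<c c<a)) = refl

orderIso-312⁻ : ∀ u → orderIso u p312 ≡ true → ∃ λ a → ∃₂ λ b c → u ≡ a ∷ b ∷ c ∷ [] × b < c × c < a
orderIso-312⁻ (a ∷ b ∷ c ∷ []) h
  with All.all⁺ (λ p → all (agree p) (zip (a ∷ b ∷ c ∷ []) p312)) (zip (a ∷ b ∷ c ∷ []) p312) (T-from-true h)
... | _ ∷ row-b ∷ row-c ∷ []
  with All.all⁺ (agree (b , 1)) (zip (a ∷ b ∷ c ∷ []) p312) row-b
     | All.all⁺ (agree (c , 2)) (zip (a ∷ b ∷ c ∷ []) p312) row-c
... | _ ∷ _ ∷ b-c ∷ [] | c-a ∷ _ =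
  a , b , c , refl , <ᵇ⇒< b c (subst T (does≟true _) b-c) , <ᵇ⇒< c a (subst T (does≟true _) c-a)

allBelow⁻ : ∀ {v} u → all (_<ᵇ v) u ≡ true → All (_< v) u
allBelow⁻ {v} u h = All.map (λ {a} → <ᵇ⇒< a v) (All.all⁺ (_<ᵇ v) u (T-from-true h))

allBelow⁺ : ∀ {v u} → All (_< v) u → all (_<ᵇ v) u ≡ true
allBelow⁺ {v} h = true-from-T (All.all⁻ (_<ᵇ v) (All.map <⇒<ᵇ h))

isDecreasing-⊆ : ∀ {u w} → u ⊆ w → isDecreasing w ≡ true → isDecreasing u ≡ true
isDecreasing-⊆ [] _ = refl
isDecreasing-⊆ {w = x ∷ w} (.x ∷ʳ s) h = isDecreasing-⊆ s (proj₂ (∧-true⁻ {all (_<ᵇ x) w} h))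
isDecreasing-⊆ {w = x ∷ w} (refl ∷ s) h with ∧-true⁻ {all (_<ᵇ x) w} h
... | below , dec = ∧-true⁺ (allBelow⁺ {x} (Sublist.All-resp-⊆ s (allBelow⁻ w below))) (isDecreasing-⊆ s dec)

isDecreasing-pair : ∀ {a b w} → a ∷ b ∷ [] ⊆ w → isDecreasing w ≡ true → b < a
isDecreasing-pair {a} {b} s h =
  <ᵇ-true⁻ (proj₁ (∧-true⁻ {b <ᵇ a} (proj₁ (∧-true⁻ {(b <ᵇ a) ∧ true} (isDecreasing-⊆ s h)))))

isDecreasing-∷ : ∀ {v u} → All (_< v) u → isDecreasing u ≡ true → isDecreasing (v ∷ u) ≡ true
isDecreasing-∷ below dec = ∧-true⁺ (allBelow⁺ below) dec

ascent-of-nonDecreasing : ∀ ys → Unique ys → isDecreasing ys ≡ false → ∃₂ λ b c → b ∷ c ∷ [] ⊆ ys × b < c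
ascent-of-nonDecreasing (y ∷ ys) (y≢ys ∷ unique) h with all (_<ᵇ y) ys in below
... | true with ascent-of-nonDecreasing ys unique h
...   | b , c , s , b<c = b , c , y ∷ʳ s , b<c
ascent-of-nonDecreasing (y ∷ ys) (y≢ys ∷ unique) h | false with above ys y≢ys below
  where
  above : ∀ zs → All (y ≢_) zs → all (_<ᵇ y) zs ≡ false → ∃ λ a → a ∷ [] ⊆ zs × y < a
  above (z ∷ zs) (y≢z ∷ y≢zs) h with z <ᵇ y in z<y
  ... | true with above zs y≢zs h
  ...   | a , s , y<a = a , z ∷ʳ s , y<a
  above (z ∷ zs) (y≢z ∷ y≢zs) h | false = z , refl ∷ minimum zs , ≤∧≢⇒< (<ᵇ-false⁻ z<y) y≢z
... | a , s , y<a = y , a , refl ∷ s , y<a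

increasing-++⁻ˡ : ∀ u₁ u₂ → increasing (u₁ ++ u₂) ≡ true → increasing u₁ ≡ true
increasing-++⁻ˡ [] u₂ h = refl
increasing-++⁻ˡ (a ∷ []) u₂ h = refl
increasing-++⁻ˡ (a ∷ b ∷ u₁) u₂ h =
  let a<b , rest = ∧-true⁻ {a <ᵇ b} h in ∧-true⁺ a<b (increasing-++⁻ˡ (b ∷ u₁) u₂ rest)

increasing-++⁻ʳ : ∀ u₁ u₂ → increasing (u₁ ++ u₂) ≡ true → increasing u₂ ≡ true
increasing-++⁻ʳ [] u₂ h = h
increasing-++⁻ʳ (a ∷ []) [] h = refl
increasing-++⁻ʳ (a ∷ []) (b ∷ u₂) h = proj₂ (∧-true⁻ {a <ᵇ b} h)
increasing-++⁻ʳ (a ∷ b ∷ u₁) u₂ h = increasing-++⁻ʳ (b ∷ u₁) u₂ (proj₂ (∧-true⁻ {a <ᵇ b} h))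

increasing-∷ʳ : ∀ {v} u → increasing u ≡ true → All (_< v) u → increasing (u ++ [ v ]) ≡ true
increasing-∷ʳ [] _ _ = refl
increasing-∷ʳ (a ∷ []) _ (a<v ∷ []) = ∧-true⁺ (<ᵇ-true a<v) refl
increasing-∷ʳ (a ∷ b ∷ u) h (_ ∷ below) =
  let a<b , rest = ∧-true⁻ {a <ᵇ b} h in ∧-true⁺ a<b (increasing-∷ʳ (b ∷ u) rest below)

increasing-⊆-isDecreasing : ∀ {u w} → u ⊆ w → isDecreasing w ≡ true → increasing u ≡ true → length u ≤ 1
increasing-⊆-isDecreasing {[]} _ _ _ = z≤n
increasing-⊆-isDecreasing {a ∷ []} _ _ _ = s≤s z≤n
increasing-⊆-isDecreasing {a ∷ b ∷ u} s dec inc =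
  ⊥-elim (<-asym (<ᵇ-true⁻ (proj₁ (∧-true⁻ {a <ᵇ b} inc)))
                 (isDecreasing-pair (⊆-trans (refl ∷ refl ∷ minimum u) s) dec))

increasing? : ∀ u → Dec (increasing u ≡ true)
increasing? u = increasing u ≟𝔹 true

lis-upper : ∀ {u σ} → u ⊆ σ → increasing u ≡ true → length u ≤ lis σ
lis-upper s inc = foldr-⊔-upper (∈-map⁺ length (∈-filter⁺ increasing? (∈-subseqs⁺ s) inc))

lis-witness : ∀ σ → ∃ λ u → u ⊆ σ × increasing u ≡ true × length u ≡ lis σ
lis-witness σ with foldr-⊔-attained (map length (filter increasing? (subseqs σ)))
... | inj₁ ≡0 = [] , minimum σ , refl , sym ≡0
... | inj₂ ∈lengths with ∈-map⁻ length ∈lengths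
...   | u , u∈ , ≡u with ∈-filter⁻ increasing? u∈
...     | u∈subseqs , inc = u , ∈-subseqs⁻ σ u∈subseqs , inc , sym ≡u

finalRun : List ℕ → ℕ
finalRun [] = 0
finalRun (x ∷ u) = if isDecreasing (x ∷ u) then suc (length u) else finalRun u

finalRun-decreasing : ∀ x u → isDecreasing (x ∷ u) ≡ true → finalRun (x ∷ u) ≡ suc (length u)
finalRun-decreasing x u h = cong (if_then suc (length u) else finalRun u) h

finalRun-nonDecreasing : ∀ x u → isDecreasing (x ∷ u) ≡ false → finalRun (x ∷ u) ≡ finalRun u
finalRun-nonDecreasing x u h = cong (if_then suc (length u) else finalRun u) h

finalRun≤length : ∀ π → finalRun π ≤ length π
finalRun≤length [] = z≤n
finalRun≤length (x ∷ u) with isDecreasing (x ∷ u)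
... | true = ≤-refl
... | false = m≤n⇒m≤1+n (finalRun≤length u)

finalRun-pos : ∀ x u → 0 < finalRun (x ∷ u)
finalRun-pos x [] = s≤s z≤n
finalRun-pos x (y ∷ u) with isDecreasing (x ∷ y ∷ u)
... | true = s≤s z≤n
... | false = finalRun-pos y u

finalRun-suffix⁺ : ∀ xs ys → isDecreasing ys ≡ true → length ys ≤ finalRun (xs ++ ys)
finalRun-suffix⁺ [] [] _ = z≤n
finalRun-suffix⁺ [] (y ∷ ys) dec = ≤-reflexive (sym (finalRun-decreasing y ys dec))
finalRun-suffix⁺ (x ∷ xs) ys dec with isDecreasing (x ∷ xs ++ ys)
... | true = ≤-trans (m≤n+m (length ys) (length xs)) (≤-trans (≤-reflexive (sym (length-++ xs))) (n≤1+n _))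
... | false = finalRun-suffix⁺ xs ys dec

finalRun-suffix⁻ : ∀ xs ys → length ys ≤ finalRun (xs ++ ys) → isDecreasing ys ≡ true
finalRun-suffix⁻ [] [] _ = refl
finalRun-suffix⁻ [] (y ∷ ys) h with isDecreasing (y ∷ ys)
... | true = refl
... | false = ⊥-elim (<-irrefl refl (≤-trans h (finalRun≤length ys)))
finalRun-suffix⁻ (x ∷ xs) ys h with isDecreasing (x ∷ xs ++ ys) in dec
... | true = isDecreasing-⊆ (Sublist.++⁺ˡ (x ∷ xs) ⊆-refl) dec
... | false = finalRun-suffix⁻ xs ys h

finalRun-split : ∀ π → ∃₂ λ xs ys → π ≡ xs ++ ys × length ys ≡ finalRun π × isDecreasing ys ≡ true
finalRun-split [] = [] , [] , refl , refl , refl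
finalRun-split (x ∷ u) with isDecreasing (x ∷ u) in dec
... | true = [] , x ∷ u , refl , refl , dec
... | false with finalRun-split u
...   | xs , ys , refl , len , ys-dec = x ∷ xs , ys , refl , len , ys-dec

-- Inserting a new maximum

nonDecreasing-before-larger : ∀ {a v} xs ys → a < v → isDecreasing (a ∷ xs ++ v ∷ ys) ≡ false
nonDecreasing-before-larger {a} {v} xs ys a<v with all (_<ᵇ a) (xs ++ v ∷ ys) in below
... | true with All.++⁻ʳ xs (allBelow⁻ (xs ++ v ∷ ys) below)
...   | v<a ∷ _ = ⊥-elim (<-asym a<v v<a)
nonDecreasing-before-larger xs ys a<v | false = refl

finalRun-insert : ∀ {v} xs ys → All (_< v) xs → All (_< v) ys → isDecreasing ys ≡ true →
  finalRun (xs ++ v ∷ ys) ≡ suc (length ys)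
finalRun-insert {v} [] ys _ ys<v dec = finalRun-decreasing v ys (isDecreasing-∷ ys<v dec)
finalRun-insert {v} (a ∷ xs) ys (a<v ∷ xs<v) ys<v dec =
  trans (finalRun-nonDecreasing a (xs ++ v ∷ ys) (nonDecreasing-before-larger xs ys a<v)) (finalRun-insert xs ys xs<v ys<v dec)

finalRun-insert-pos : ∀ xs (v : ℕ) ys → 0 < finalRun (xs ++ v ∷ ys)
finalRun-insert-pos [] v ys = finalRun-pos v ys
finalRun-insert-pos (x ∷ xs) v ys = finalRun-pos x (xs ++ v ∷ ys)

contains-312-insert⁻ : ∀ {v} xs ys → All (_< v) xs → All (_< v) ys →
  contains (xs ++ v ∷ ys) p312 ≡ true → contains (xs ++ ys) p312 ≡ true ⊎ isDecreasing ys ≡ false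
contains-312-insert⁻ {v} xs ys xs<v ys<v h with contains⁻ (xs ++ v ∷ ys) p312 h
... | u , u⊆ , iso with ⊆-++⁻ xs u⊆
... | u₁ , u₂ , refl , u₁⊆ , .v ∷ʳ u₂⊆ = inj₁ (contains⁺ p312 (Sublist.++⁺ u₁⊆ u₂⊆) iso)
... | u₁ , .v ∷ u₂ , refl , u₁⊆ , refl ∷ u₂⊆ with orderIso-312⁻ _ iso
...   | a , b , c , u≡ , b<c , c<a = pattern-position u₁ u₂ u≡ u₁⊆ u₂⊆
  where
  pattern-position : ∀ u₁ u₂ → u₁ ++ v ∷ u₂ ≡ a ∷ b ∷ c ∷ [] → u₁ ⊆ xs → u₂ ⊆ ys →
                     contains (xs ++ ys) p312 ≡ true ⊎ isDecreasing ys ≡ false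
  pattern-position [] (.b ∷ .c ∷ []) refl _ bc⊆ with isDecreasing ys in dec
  ... | true = ⊥-elim (<-asym b<c (isDecreasing-pair bc⊆ dec))
  ... | false = inj₂ refl
  pattern-position (.a ∷ []) (.c ∷ []) refl _ c⊆ with Sublist.All-resp-⊆ c⊆ ys<v
  ... | c<b ∷ [] = ⊥-elim (<-asym b<c c<b)
  pattern-position (.a ∷ .b ∷ []) [] refl ab⊆ _ with Sublist.All-resp-⊆ ab⊆ xs<v
  ... | a<c ∷ _ = ⊥-elim (<-asym c<a a<c)
  pattern-position (_ ∷ _ ∷ _ ∷ []) _ () _ _
  pattern-position (_ ∷ _ ∷ _ ∷ _ ∷ _) _ () _ _

avoids-312-insert : ∀ {v} xs ys → All (_< v) xs → All (_< v) ys → Unique ys →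
  avoids (xs ++ v ∷ ys) p312 ≡ avoids (xs ++ ys) p312 ∧ isDecreasing ys
avoids-312-insert {v} xs ys xs<v ys<v unique = ≡-from-⇔ forward backward
  where
  forward : avoids (xs ++ v ∷ ys) p312 ≡ true → avoids (xs ++ ys) p312 ∧ isDecreasing ys ≡ true
  forward av =
    ∧-true⁺ (avoids⁺ (xs ++ ys) p312 (avoids⁻ (xs ++ v ∷ ys) p312 av ∘ contains-⊆ p312 (delete-⊆ xs v ys))) ys-decreasing
    where
    ys-decreasing : isDecreasing ys ≡ true
    ys-decreasing with isDecreasing ys in dec
    ... | true = refl
    ... | false with ascent-of-nonDecreasing ys unique dec
    ...   | b , c , bc⊆ , b<c with Sublist.All-resp-⊆ bc⊆ ys<v
    ...     | _ ∷ c<v ∷ [] =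
      ⊥-elim (avoids⁻ (xs ++ v ∷ ys) p312 av
                (contains⁺ p312 (Sublist.++⁺ (minimum xs) (refl ∷ bc⊆)) (orderIso-312⁺ b<c c<v)))
  backward : avoids (xs ++ ys) p312 ∧ isDecreasing ys ≡ true → avoids (xs ++ v ∷ ys) p312 ≡ true
  backward h with ∧-true⁻ {avoids (xs ++ ys) p312} h
  ... | av , dec = avoids⁺ (xs ++ v ∷ ys) p312 (λ c → case (contains-312-insert⁻ xs ys xs<v ys<v c))
    where
    case : contains (xs ++ ys) p312 ≡ true ⊎ isDecreasing ys ≡ false → ⊥
    case (inj₁ c) = avoids⁻ (xs ++ ys) p312 av c
    case (inj₂ nd) = not-¬ nd dec

contains-decreasing-insert⁻ : ∀ {v} B xs ys → All (_< v) xs →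
  contains (xs ++ v ∷ ys) (decreasing (suc B)) ≡ true →
  contains (xs ++ ys) (decreasing (suc B)) ≡ true ⊎ B ≤ length ys
contains-decreasing-insert⁻ {v} B xs ys xs<v h with contains⁻ (xs ++ v ∷ ys) (decreasing (suc B)) h
... | u , u⊆ , iso with orderIso-decreasing⁻ u (suc B) iso | ⊆-++⁻ xs u⊆
... | _ | u₁ , u₂ , refl , u₁⊆ , .v ∷ʳ u₂⊆ = inj₁ (contains⁺ _ (Sublist.++⁺ u₁⊆ u₂⊆) iso)
... | len , _ | [] , .v ∷ u₂ , refl , _ , refl ∷ u₂⊆ =
  inj₂ (≤-trans (≤-reflexive (suc-injective (sym len))) (Sublist.length-mono-≤ u₂⊆))
... | _ , dec | x ∷ u₁ , .v ∷ u₂ , refl , x∷u₁⊆ , refl ∷ _ with Sublist.All-resp-⊆ x∷u₁⊆ xs<v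
...   | x<v ∷ _ = ⊥-elim (<-asym x<v (isDecreasing-pair (refl ∷ Sublist.++⁺ (minimum u₁) (refl ∷ minimum u₂)) dec))

contains-decreasing : ∀ {w σ} B → w ⊆ σ → isDecreasing w ≡ true → B ≤ length w → contains σ (decreasing B) ≡ true
contains-decreasing {w} B w⊆σ dec B≤w =
  contains⁺ _ (⊆-trans (Sublist.take-⊆ B w) w⊆σ)
    (subst (λ k → orderIso (take B w) (decreasing k) ≡ true) (trans (length-take B w) (m≤n⇒m⊓n≡m B≤w))
      (orderIso-decreasing⁺ (take B w) (isDecreasing-⊆ (Sublist.take-⊆ B w) dec)))

avoids-decreasing-insert : ∀ {v} B xs ys → All (_< v) xs → All (_< v) ys → isDecreasing ys ≡ true →
  avoids (xs ++ v ∷ ys) (decreasing (suc B)) ≡ avoids (xs ++ ys) (decreasing (suc B)) ∧ (length ys <ᵇ B)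
avoids-decreasing-insert {v} B xs ys xs<v ys<v dec = ≡-from-⇔ forward backward
  where
  forward : avoids (xs ++ v ∷ ys) (decreasing (suc B)) ≡ true →
            avoids (xs ++ ys) (decreasing (suc B)) ∧ (length ys <ᵇ B) ≡ true
  forward av = ∧-true⁺ (avoids⁺ (xs ++ ys) _ (avoids⁻ (xs ++ v ∷ ys) _ av ∘ contains-⊆ _ (delete-⊆ xs v ys))) short
    where
    short : (length ys <ᵇ B) ≡ true
    short with length ys <ᵇ B in ys<B
    ... | true = refl
    ... | false =
      ⊥-elim (avoids⁻ (xs ++ v ∷ ys) _ av
                (contains-decreasing (suc B) (Sublist.++⁺ (minimum xs) ⊆-refl) (isDecreasing-∷ ys<v dec) (s≤s (<ᵇ-false⁻ ys<B))))
  backward : avoids (xs ++ ys) (decreasing (suc B)) ∧ (length ys <ᵇ B) ≡ true →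
             avoids (xs ++ v ∷ ys) (decreasing (suc B)) ≡ true
  backward h with ∧-true⁻ {avoids (xs ++ ys) (decreasing (suc B))} h
  ... | av , ys<B = avoids⁺ (xs ++ v ∷ ys) _ (λ c → case (contains-decreasing-insert⁻ B xs ys xs<v c))
    where
    case : contains (xs ++ ys) (decreasing (suc B)) ≡ true ⊎ B ≤ length ys → ⊥
    case (inj₁ c) = avoids⁻ (xs ++ ys) _ av c
    case (inj₂ B≤ys) = <⇒≱ (<ᵇ-true⁻ ys<B) B≤ys

lis-insert : ∀ {v} xs ys → All (_< v) xs → All (_< v) ys → isDecreasing ys ≡ true →
  lis (xs ++ v ∷ ys) ≡ suc (lis xs)
lis-insert {v} xs ys xs<v ys<v dec = ≤-antisym at-most at-least
  where
  open ≤-Reasoning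
  at-least : suc (lis xs) ≤ lis (xs ++ v ∷ ys)
  at-least with lis-witness xs
  ... | u , u⊆ , inc , len = begin
    suc (lis xs)        ≡⟨ cong suc len ⟨
    suc (length u)      ≡⟨ +-comm 1 (length u) ⟩
    length u + 1        ≡⟨ length-++ u ⟨
    length (u ++ [ v ]) ≤⟨ lis-upper (Sublist.++⁺ u⊆ (refl ∷ minimum ys))
                                     (increasing-∷ʳ u inc (Sublist.All-resp-⊆ u⊆ xs<v)) ⟩
    lis (xs ++ v ∷ ys)  ∎
  at-most : lis (xs ++ v ∷ ys) ≤ suc (lis xs)
  at-most with lis-witness (xs ++ v ∷ ys)
  ... | u , u⊆ , inc , len with ⊆-++⁻ xs u⊆
  ...   | u₁ , u₂ , refl , u₁⊆ , u₂⊆ = begin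
    lis (xs ++ v ∷ ys)     ≡⟨ len ⟨
    length (u₁ ++ u₂)      ≡⟨ length-++ u₁ ⟩
    length u₁ + length u₂  ≤⟨ +-mono-≤ (lis-upper u₁⊆ (increasing-++⁻ˡ u₁ u₂ inc))
                                       (increasing-⊆-isDecreasing u₂⊆ (isDecreasing-∷ ys<v dec)
                                                                  (increasing-++⁻ʳ u₁ u₂ inc)) ⟩
    lis xs + 1             ≡⟨ +-comm (lis xs) 1 ⟩
    suc (lis xs)           ∎

-- How lis changes when the maximum is inserted before the last k entries of a
-- 312-avoider with final run s ≥ k; s = 0 only for the empty permutation.
lisGain : ℕ → ℕ → ℕ
lisGain k zero = 1
lisGain k (suc s) = if k <ᵇ suc s then 1 else 0

lisGain-0 : ∀ s → lisGain 0 s ≡ 1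
lisGain-0 zero = refl
lisGain-0 (suc s) = refl

InsertionLis : List ℕ → Set
InsertionLis π = ∀ xs ys → π ≡ xs ++ ys → length ys ≤ finalRun π →
                 suc (lis xs) ≡ lis π + lisGain (length ys) (finalRun π)

insertionLis-[] : InsertionLis []
insertionLis-[] [] [] refl _ = refl

insertionLis-insert : ∀ {v} xs ys → All (_< v) xs → All (_< v) ys → isDecreasing ys ≡ true →
  InsertionLis (xs ++ v ∷ ys)
insertionLis-insert {v} xs ys xs<v ys<v dec as bs σ≡ bs≤run
  rewrite finalRun-insert xs ys xs<v ys<v dec | lis-insert xs ys xs<v ys<v dec
  with ++-suffix xs (v ∷ ys) as bs σ≡ bs≤run
... | [] , refl , refl
  rewrite ++-identityʳ xs | <ᵇ-false {suc (length ys)} ≤-refl = sym (+-identityʳ _)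
... | .v ∷ cs , refl , refl
  rewrite <ᵇ-true {length bs} {suc (length (cs ++ bs))} (s≤s (≤-trans (m≤n+m _ _) (≤-reflexive (sym (length-++ cs)))))
        | lis-insert xs cs xs<v (All.++⁻ˡ cs ys<v) (isDecreasing-⊆ {cs} (Sublist.++⁺ʳ bs ⊆-refl) dec)
  = sym (+-comm (suc (lis xs)) 1)

lis-insert-gain : ∀ {v} xs ys → All (_< v) xs → All (_< v) ys → isDecreasing ys ≡ true → InsertionLis (xs ++ ys) →
  lis (xs ++ v ∷ ys) ≡ lis (xs ++ ys) + lisGain (length ys) (finalRun (xs ++ ys))
lis-insert-gain xs ys xs<v ys<v dec insertionLis =
  trans (lis-insert xs ys xs<v ys<v dec) (insertionLis xs ys refl (finalRun-suffix⁺ xs ys dec))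

record IsPerm (n : ℕ) (π : List ℕ) : Set where
  field
    length≡ : length π ≡ n
    bounded : All (_≤ n) π
    unique : Unique π

IsPerm-insert : ∀ {n} xs ys → IsPerm n (xs ++ ys) → IsPerm (suc n) (xs ++ suc n ∷ ys)
IsPerm-insert {n} xs ys π = record
  { length≡ = begin
      length (xs ++ suc n ∷ ys)    ≡⟨ length-++ xs ⟩
      length xs + suc (length ys)  ≡⟨ +-suc (length xs) (length ys) ⟩
      suc (length xs + length ys)  ≡⟨ cong suc (length-++ xs) ⟨
      suc (length (xs ++ ys))      ≡⟨ cong suc length≡ ⟩
      suc n                        ∎
  ; bounded = All-insert xs ys (All.map m≤n⇒m≤1+n bounded) ≤-refl
  ; unique = Unique-insert xs ys (All.map s≤s bounded) unique
  }
  where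
  open IsPerm π
  open ≡-Reasoning

All-insertAll : ∀ {P : List ℕ → Set} v π → (∀ xs ys → π ≡ xs ++ ys → P (xs ++ v ∷ ys)) → All P (insertAll v π)
All-insertAll v [] h = h [] [] refl ∷ []
All-insertAll v (y ∷ π) h =
  h [] (y ∷ π) refl ∷ All.map⁺ (All-insertAll v π (λ xs ys π≡ → h (y ∷ xs) ys (cong (y ∷_) π≡)))

All-concatMap : ∀ {P Q : List ℕ → Set} (f : List ℕ → List (List ℕ)) {L} →
  (∀ {π} → P π → All Q (f π)) → All P L → All Q (concatMap f L)
All-concatMap f g ps = All.concat⁺ (All.map⁺ (All.map g ps))

perms-IsPerm : ∀ n → All (IsPerm n) (perms n)

All-perms-insertion : ∀ {P : List ℕ → Set} n →
  (∀ xs ys → IsPerm n (xs ++ ys) → P (xs ++ suc n ∷ ys)) → All P (perms (suc n))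

perms-IsPerm zero = record { length≡ = refl ; bounded = [] ; unique = [] } ∷ []
perms-IsPerm (suc n) = All-perms-insertion n IsPerm-insert

All-perms-insertion n h =
  All-concatMap (insertAll (suc n))
    (λ {π} p → All-insertAll (suc n) π (λ xs ys π≡ → h xs ys (subst (IsPerm n) π≡ p)))
    (perms-IsPerm n)

IsPerm-below : ∀ {n} xs ys → IsPerm n (xs ++ ys) → All (_< suc n) xs × All (_< suc n) ys
IsPerm-below xs ys π = All.++⁻ xs (All.map s≤s (IsPerm.bounded π))

perms-insertionLis : ∀ n → All (λ σ → avoids σ p312 ≡ true → InsertionLis σ) (perms n)
perms-insertionLis zero = (λ _ → insertionLis-[]) ∷ []
perms-insertionLis (suc n) = All-perms-insertion n insertion
  where
  insertion : ∀ xs ys → IsPerm n (xs ++ ys) → avoids (xs ++ suc n ∷ ys) p312 ≡ true → InsertionLis (xs ++ suc n ∷ ys)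
  insertion xs ys π av =
    let xs<v , ys<v = IsPerm-below xs ys π
        avoids-dec = trans (sym (avoids-312-insert xs ys xs<v ys<v (Unique-++⁻ʳ xs (IsPerm.unique π)))) av
    in insertionLis-insert xs ys xs<v ys<v (proj₂ (∧-true⁻ {avoids (xs ++ ys) p312} avoids-dec))

indicator-≤ᵇ-suc : ∀ c m k →
  indicator (c ∧ (suc m ≡ᵇ k)) + indicator (c ∧ (k ≤ᵇ m)) ≡ indicator (c ∧ (k ≤ᵇ suc m))
indicator-≤ᵇ-suc false m k = refl
indicator-≤ᵇ-suc true m zero = refl
indicator-≤ᵇ-suc true m (suc k) with <-cmp k m
... | tri< k<m _ _ rewrite ≡ᵇ-false {m} {k} (>⇒≢ k<m) | <ᵇ-true k<m | <ᵇ-true (m<n⇒m<1+n k<m) = refl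
... | tri≈ _ refl _ rewrite ≡ᵇ-refl k | <ᵇ-false {k} {k} ≤-refl | <ᵇ-true (n<1+n k) = refl
... | tri> _ _ m<k rewrite ≡ᵇ-false {m} {k} (<⇒≢ m<k) | <ᵇ-false {k} {m} (<⇒≤ m<k) | <ᵇ-false {k} {suc m} m<k = refl

-- Exactly one insertion point leaves k entries after the new maximum.
count-insertAll : ∀ (p : List ℕ → Bool) v π k c →
  (∀ xs ys → π ≡ xs ++ ys → p (xs ++ v ∷ ys) ≡ c ∧ (length ys ≡ᵇ k)) →
  count p (insertAll v π) ≡ indicator (c ∧ (k ≤ᵇ length π))
count-insertAll p v [] k false h rewrite h [] [] refl = refl
count-insertAll p v [] zero true h rewrite h [] [] refl = refl
count-insertAll p v [] (suc k) true h rewrite h [] [] refl = refl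
count-insertAll p v (y ∷ π) k c h = begin
  indicator (p (v ∷ y ∷ π)) + count p (map (y ∷_) (insertAll v π))
    ≡⟨ cong₂ _+_ (cong indicator (h [] (y ∷ π) refl)) (count-map p (y ∷_) (insertAll v π)) ⟩
  indicator (c ∧ (suc (length π) ≡ᵇ k)) + count (p ∘ (y ∷_)) (insertAll v π)
    ≡⟨ cong (indicator (c ∧ (suc (length π) ≡ᵇ k)) +_)
            (count-insertAll (p ∘ (y ∷_)) v π k c (λ xs ys π≡ → h (y ∷ xs) ys (cong (y ∷_) π≡))) ⟩
  indicator (c ∧ (suc (length π) ≡ᵇ k)) + indicator (c ∧ (k ≤ᵇ length π))
    ≡⟨ indicator-≤ᵇ-suc c (length π) k ⟩
  indicator (c ∧ (k ≤ᵇ suc (length π))) ∎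
  where open ≡-Reasoning

good : ℕ → List ℕ → Bool
good B σ = avoids σ p312 ∧ avoids σ (decreasing (suc B))

goodWithRun goodWithRunFrom : ℕ → ℕ → List ℕ → Bool
goodWithRun B r σ = good B σ ∧ (finalRun σ ≡ᵇ r)
goodWithRunFrom B r σ = good B σ ∧ (r ≤ᵇ finalRun σ)

finalRun-bound : ∀ B σ → avoids σ (decreasing (suc B)) ≡ true → finalRun σ ≤ B
finalRun-bound B σ av with finalRun-split σ
... | xs , ys , refl , len , dec = ≮⇒≥ λ B<run →
  avoids⁻ (xs ++ ys) _ av (contains-decreasing (suc B) (Sublist.++⁺ˡ xs ⊆-refl) dec (subst (suc B ≤_) (sym len) B<run))

module _ {v : ℕ} (xs ys : List ℕ) (xs<v : All (_< v) xs) (ys<v : All (_< v) ys) (unique : Unique ys)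
         (insertionLis : avoids (xs ++ ys) p312 ≡ true → InsertionLis (xs ++ ys)) where

  insert-statistics⇒ : ∀ B k ℓ →
    goodWithRun B (suc k) (xs ++ v ∷ ys) ∧ (lis (xs ++ v ∷ ys) ≡ᵇ ℓ) ≡ true →
    (goodWithRunFrom B k (xs ++ ys) ∧ (lis (xs ++ ys) + lisGain k (finalRun (xs ++ ys)) ≡ᵇ ℓ)) ∧ (length ys ≡ᵇ k) ≡ true
  insert-statistics⇒ B k ℓ h
    with ∧-true⁻ {goodWithRun B (suc k) (xs ++ v ∷ ys)} h
  ... | σ-good-run , σ-lis
    with ∧-true⁻ {good B (xs ++ v ∷ ys)} σ-good-run
  ... | σ-good , σ-run
    with ∧-true⁻ {avoids (xs ++ v ∷ ys) p312} σ-good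
  ... | σ-312 , σ-dec
    with ∧-true⁻ {avoids (xs ++ ys) p312} (trans (sym (avoids-312-insert xs ys xs<v ys<v unique)) σ-312)
  ... | π-312 , ys-dec
    with ∧-true⁻ {avoids (xs ++ ys) (decreasing (suc B))} (trans (sym (avoids-decreasing-insert B xs ys xs<v ys<v ys-dec)) σ-dec)
  ... | π-dec , _ =
    ∧-true⁺ (∧-true⁺ (∧-true⁺ (∧-true⁺ π-312 π-dec) (≤ᵇ-true k≤run)) π-lis)
            (subst (λ j → (j ≡ᵇ k) ≡ true) (sym ys≡k) (≡ᵇ-refl k))
    where
    ys≡k : length ys ≡ k
    ys≡k = suc-injective (trans (sym (finalRun-insert xs ys xs<v ys<v ys-dec)) (≡ᵇ-true⁻ σ-run))
    k≤run : k ≤ finalRun (xs ++ ys)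
    k≤run = subst (_≤ finalRun (xs ++ ys)) ys≡k (finalRun-suffix⁺ xs ys ys-dec)
    π-lis : (lis (xs ++ ys) + lisGain k (finalRun (xs ++ ys)) ≡ᵇ ℓ) ≡ true
    π-lis = subst (λ j → (j ≡ᵇ ℓ) ≡ true)
                  (trans (lis-insert-gain xs ys xs<v ys<v ys-dec (insertionLis π-312))
                         (cong (λ j → lis (xs ++ ys) + lisGain j (finalRun (xs ++ ys))) ys≡k))
                  σ-lis

  insert-statistics⇐ : ∀ B k ℓ → k < B →
    (goodWithRunFrom B k (xs ++ ys) ∧ (lis (xs ++ ys) + lisGain k (finalRun (xs ++ ys)) ≡ᵇ ℓ)) ∧ (length ys ≡ᵇ k) ≡ true →
    goodWithRun B (suc k) (xs ++ v ∷ ys) ∧ (lis (xs ++ v ∷ ys) ≡ᵇ ℓ) ≡ true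
  insert-statistics⇐ B k ℓ k<B h
    with ∧-true⁻ {goodWithRunFrom B k (xs ++ ys) ∧ (lis (xs ++ ys) + lisGain k (finalRun (xs ++ ys)) ≡ᵇ ℓ)} h
  ... | π-stats , ys-k
    with ∧-true⁻ {goodWithRunFrom B k (xs ++ ys)} π-stats
  ... | π-good-run , π-lis
    with ∧-true⁻ {good B (xs ++ ys)} π-good-run
  ... | π-good , π-run
    with ∧-true⁻ {avoids (xs ++ ys) p312} π-good
  ... | π-312 , π-dec =
    ∧-true⁺ (∧-true⁺ (∧-true⁺ σ-312 σ-dec) σ-run) σ-lis
    where
    ys≡k : length ys ≡ k
    ys≡k = ≡ᵇ-true⁻ ys-k
    ys-dec : isDecreasing ys ≡ true
    ys-dec = finalRun-suffix⁻ xs ys (subst (_≤ finalRun (xs ++ ys)) (sym ys≡k) (≤ᵇ-true⁻ π-run))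
    σ-312 : avoids (xs ++ v ∷ ys) p312 ≡ true
    σ-312 = trans (avoids-312-insert xs ys xs<v ys<v unique) (∧-true⁺ π-312 ys-dec)
    σ-dec : avoids (xs ++ v ∷ ys) (decreasing (suc B)) ≡ true
    σ-dec = trans (avoids-decreasing-insert B xs ys xs<v ys<v ys-dec)
                  (∧-true⁺ π-dec (<ᵇ-true (subst (_< B) (sym ys≡k) k<B)))
    σ-run : (finalRun (xs ++ v ∷ ys) ≡ᵇ suc k) ≡ true
    σ-run = subst (λ j → (j ≡ᵇ suc k) ≡ true)
                  (sym (trans (finalRun-insert xs ys xs<v ys<v ys-dec) (cong suc ys≡k))) (≡ᵇ-refl k)
    σ-lis : (lis (xs ++ v ∷ ys) ≡ᵇ ℓ) ≡ true
    σ-lis = subst (λ j → (j ≡ᵇ ℓ) ≡ true)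
                  (sym (trans (lis-insert-gain xs ys xs<v ys<v ys-dec (insertionLis π-312))
                              (cong (λ j → lis (xs ++ ys) + lisGain j (finalRun (xs ++ ys))) ys≡k)))
                  π-lis

  insert-statistics : ∀ B k ℓ → k < B →
    goodWithRun B (suc k) (xs ++ v ∷ ys) ∧ (lis (xs ++ v ∷ ys) ≡ᵇ ℓ)
      ≡ (goodWithRunFrom B k (xs ++ ys) ∧ (lis (xs ++ ys) + lisGain k (finalRun (xs ++ ys)) ≡ᵇ ℓ)) ∧ (length ys ≡ᵇ k)
  insert-statistics B k ℓ k<B = ≡-from-⇔ (insert-statistics⇒ B k ℓ) (insert-statistics⇐ B k ℓ k<B)

insertAll-statistics : ∀ B k ℓ n π → k < B → IsPerm n π → (avoids π p312 ≡ true → InsertionLis π) →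
  ∀ xs ys → π ≡ xs ++ ys →
  goodWithRun B (suc k) (xs ++ suc n ∷ ys) ∧ (lis (xs ++ suc n ∷ ys) ≡ᵇ ℓ)
    ≡ (goodWithRunFrom B k π ∧ (lis π + lisGain k (finalRun π) ≡ᵇ ℓ)) ∧ (length ys ≡ᵇ k)
insertAll-statistics B k ℓ n _ k<B isPerm insertionLis xs ys refl =
  let xs<v , ys<v = IsPerm-below xs ys isPerm
  in insert-statistics xs ys xs<v ys<v (Unique-++⁻ʳ xs (IsPerm.unique isPerm)) insertionLis B k ℓ k<B

count-perms-suc : ∀ B k ℓ n → k < B →
  count (λ σ → goodWithRun B (suc k) σ ∧ (lis σ ≡ᵇ ℓ)) (perms (suc n))
    ≡ count (λ π → goodWithRunFrom B k π ∧ (lis π + lisGain k (finalRun π) ≡ᵇ ℓ)) (perms n)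
count-perms-suc B k ℓ n k<B =
  count-concatMap _ (insertAll (suc n)) _ (All.zipWith per-perm (perms-IsPerm n , perms-insertionLis n))
  where
  stat : List ℕ → Bool
  stat π = goodWithRunFrom B k π ∧ (lis π + lisGain k (finalRun π) ≡ᵇ ℓ)
  per-perm : ∀ {π} → IsPerm n π × (avoids π p312 ≡ true → InsertionLis π) →
             count (λ σ → goodWithRun B (suc k) σ ∧ (lis σ ≡ᵇ ℓ)) (insertAll (suc n) π) ≡ indicator (stat π)
  per-perm {π} (isPerm , insertionLis) =
    trans (count-insertAll _ (suc n) π k (stat π) (insertAll-statistics B k ℓ n π k<B isPerm insertionLis))
          position-exists
    where
    position-exists : indicator (stat π ∧ (k ≤ᵇ length π)) ≡ indicator (stat π)
    position-exists = indicator-∧ (stat π) λ e →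
      let _ , k≤run = ∧-true⁻ {good B π} (proj₁ (∧-true⁻ {goodWithRunFrom B k π} e))
      in ≤ᵇ-true (≤-trans (≤ᵇ-true⁻ {k} k≤run) (finalRun≤length π))

-- Power series

infix 4 _≈_
_≈_ : Series → Series → Set
A ≈ B = ∀ n ℓ → A n ℓ ≡ B n ℓ

≈-setoid : Setoid 0ℓ 0ℓ
≈-setoid = record
  { Carrier = Series
  ; _≈_ = _≈_
  ; isEquivalence = record
    { refl = λ _ _ → refl
    ; sym = λ p n ℓ → sym (p n ℓ)
    ; trans = λ p q n ℓ → trans (p n ℓ) (q n ℓ)
    }
  }

open Setoid ≈-setoid using () renaming (refl to ≈-refl; sym to ≈-sym; trans to ≈-trans)

module ≈-Reasoning = SetoidReasoning ≈-setoid

𝟘 : Series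
𝟘 n ℓ = 0ℤ

infixr 8 x·_ q·_

x·_ : Series → Series
(x· A) zero ℓ = 0ℤ
(x· A) (suc n) ℓ = A n ℓ

q·_ : Series → Series
(q· A) n zero = 0ℤ
(q· A) n (suc ℓ) = A n ℓ

⊕-cong : ∀ {A A′ B B′} → A ≈ A′ → B ≈ B′ → A ⊕ B ≈ A′ ⊕ B′
⊕-cong p q n ℓ = cong₂ ℤ._+_ (p n ℓ) (q n ℓ)

⊖-cong : ∀ {A A′ B B′} → A ≈ A′ → B ≈ B′ → A ⊖ B ≈ A′ ⊖ B′
⊖-cong p q n ℓ = cong₂ ℤ._-_ (p n ℓ) (q n ℓ)

x·-cong : ∀ {A A′} → A ≈ A′ → x· A ≈ x· A′
x·-cong p zero ℓ = refl
x·-cong p (suc n) ℓ = p n ℓ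

q·-cong : ∀ {A A′} → A ≈ A′ → q· A ≈ q· A′
q·-cong p n zero = refl
q·-cong p n (suc ℓ) = p n ℓ

x·-⊕ : ∀ A B → x· (A ⊕ B) ≈ x· A ⊕ x· B
x·-⊕ A B zero ℓ = refl
x·-⊕ A B (suc n) ℓ = refl

x·-⊖ : ∀ A B → x· (A ⊖ B) ≈ x· A ⊖ x· B
x·-⊖ A B zero ℓ = refl
x·-⊖ A B (suc n) ℓ = refl

q·-⊕ : ∀ A B → q· (A ⊕ B) ≈ q· A ⊕ q· B
q·-⊕ A B n zero = refl
q·-⊕ A B n (suc ℓ) = refl

q·-⊖ : ∀ A B → q· (A ⊖ B) ≈ q· A ⊖ q· B
q·-⊖ A B n zero = refl
q·-⊖ A B n (suc ℓ) = refl

q·x· : ∀ A → q· x· A ≈ x· q· A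
q·x· A zero zero = refl
q·x· A zero (suc ℓ) = refl
q·x· A (suc n) zero = refl
q·x· A (suc n) (suc ℓ) = refl

x·𝟘 : x· 𝟘 ≈ 𝟘
x·𝟘 zero ℓ = refl
x·𝟘 (suc n) ℓ = refl

-- 1 + x - xq = 2√x t is the multiplier in the homogenised Chebyshev recurrence.
infixr 8 P·_
P·_ : Series → Series
P· E = E ⊕ x· E ⊖ x· q· E

P·-cong : ∀ {A A′} → A ≈ A′ → P· A ≈ P· A′
P·-cong p = ⊖-cong (⊕-cong p (x·-cong p)) (x·-cong (q·-cong p))

P·-⊕ : ∀ A B → P· (A ⊕ B) ≈ P· A ⊕ P· B
P·-⊕ A B n ℓ
  rewrite x·-⊕ A B n ℓ | x·-cong (q·-⊕ A B) n ℓ | x·-⊕ (q· A) (q· B) n ℓ =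
  rearrange (A n ℓ) (B n ℓ) ((x· A) n ℓ) ((x· B) n ℓ) ((x· q· A) n ℓ) ((x· q· B) n ℓ)
  where
  rearrange : ∀ a b c d e f → a ℤ.+ b ℤ.+ (c ℤ.+ d) ℤ.- (e ℤ.+ f) ≡ a ℤ.+ c ℤ.- e ℤ.+ (b ℤ.+ d ℤ.- f)
  rearrange = solve-∀

P·-⊖ : ∀ A B → P· (A ⊖ B) ≈ P· A ⊖ P· B
P·-⊖ A B n ℓ
  rewrite x·-⊖ A B n ℓ | x·-cong (q·-⊖ A B) n ℓ | x·-⊖ (q· A) (q· B) n ℓ =
  rearrange (A n ℓ) (B n ℓ) ((x· A) n ℓ) ((x· B) n ℓ) ((x· q· A) n ℓ) ((x· q· B) n ℓ)
  where
  rearrange : ∀ a b c d e f → a ℤ.- b ℤ.+ (c ℤ.- d) ℤ.- (e ℤ.- f) ≡ a ℤ.+ c ℤ.- e ℤ.- (b ℤ.+ d ℤ.- f)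
  rearrange = solve-∀

P·x· : ∀ A → P· x· A ≈ x· P· A
P·x· A zero ℓ = refl
P·x· A (suc n) ℓ = cong (λ t → A n ℓ ℤ.+ (x· A) n ℓ ℤ.- t) (q·x· A n ℓ)

sumTo-cong : ∀ n {f g : ℕ → ℤ} → (∀ i → i ≤ n → f i ≡ g i) → sumTo n f ≡ sumTo n g
sumTo-cong zero h = h 0 z≤n
sumTo-cong (suc n) h = cong₂ ℤ._+_ (sumTo-cong n (λ i i≤n → h i (m≤n⇒m≤1+n i≤n))) (h (suc n) ≤-refl)

sumTo-zero : ∀ n {f : ℕ → ℤ} → (∀ i → i ≤ n → f i ≡ 0ℤ) → sumTo n f ≡ 0ℤ
sumTo-zero n h = trans (sumTo-cong n h) (zeros n)
  where
  zeros : ∀ n → sumTo n (λ _ → 0ℤ) ≡ 0ℤ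
  zeros zero = refl
  zeros (suc n) = cong (λ t → t ℤ.+ 0ℤ) (zeros n)

sumTo-+ : ∀ n (f g : ℕ → ℤ) → sumTo n (λ i → f i ℤ.+ g i) ≡ sumTo n f ℤ.+ sumTo n g
sumTo-+ zero f g = refl
sumTo-+ (suc n) f g rewrite sumTo-+ n f g = ℤ+.interchange (sumTo n f) (sumTo n g) (f (suc n)) (g (suc n))

sumTo-- : ∀ n (f g : ℕ → ℤ) → sumTo n (λ i → f i ℤ.- g i) ≡ sumTo n f ℤ.- sumTo n g
sumTo-- zero f g = refl
sumTo-- (suc n) f g rewrite sumTo-- n f g = rearrange (sumTo n f) (sumTo n g) (f (suc n)) (g (suc n))
  where
  rearrange : ∀ a b c d → a ℤ.- b ℤ.+ (c ℤ.- d) ≡ a ℤ.+ c ℤ.- (b ℤ.+ d)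
  rearrange = solve-∀

sumTo-single : ∀ n a (f : ℕ → ℤ) → sumTo n (λ i → if a ≡ᵇ i then f i else 0ℤ) ≡ (if a ≤ᵇ n then f a else 0ℤ)
sumTo-single zero zero f = refl
sumTo-single zero (suc a) f = refl
sumTo-single (suc n) a f rewrite sumTo-single n a f with <-cmp a (suc n)
... | tri< a<1+n _ _ rewrite ≤ᵇ-true (≤-pred a<1+n) | ≡ᵇ-false (<⇒≢ a<1+n) | ≤ᵇ-true (<⇒≤ a<1+n) = ℤ.+-identityʳ (f a)
... | tri≈ _ refl _ rewrite ≤ᵇ-false (n<1+n n) | ≡ᵇ-refl (suc n) | ≤ᵇ-true (≤-refl {suc n}) = ℤ.+-identityˡ (f (suc n))
... | tri> _ _ 1+n<a rewrite ≤ᵇ-false (<-trans (n<1+n n) 1+n<a) | ≡ᵇ-false (>⇒≢ 1+n<a) | ≤ᵇ-false 1+n<a = refl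

sumTo-last : ∀ n (f : ℕ → ℤ) → (∀ i → i < n → f i ≡ 0ℤ) → sumTo n f ≡ f n
sumTo-last zero f _ = refl
sumTo-last (suc n) f h =
  trans (cong (λ t → t ℤ.+ f (suc n)) (sumTo-zero n λ i i≤n → h i (s≤s i≤n))) (ℤ.+-identityˡ (f (suc n)))

⊛-distribˡ-⊕ : ∀ A B C → A ⊛ (B ⊕ C) ≈ A ⊛ B ⊕ A ⊛ C
⊛-distribˡ-⊕ A B C n ℓ =
  trans (sumTo-cong n λ i _ →
           trans (sumTo-cong ℓ λ j _ → ℤ.*-distribˡ-+ (A i j) (B (n ∸ i) (ℓ ∸ j)) (C (n ∸ i) (ℓ ∸ j))) (sumTo-+ ℓ _ _))
        (sumTo-+ n _ _)

⊛-distribˡ-⊖ : ∀ A B C → A ⊛ (B ⊖ C) ≈ A ⊛ B ⊖ A ⊛ C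
⊛-distribˡ-⊖ A B C n ℓ =
  trans (sumTo-cong n λ i _ →
           trans (sumTo-cong ℓ λ j _ → distrib (A i j) (B (n ∸ i) (ℓ ∸ j)) (C (n ∸ i) (ℓ ∸ j))) (sumTo-- ℓ _ _))
        (sumTo-- n _ _)
  where
  distrib : ∀ a b c → a ℤ.* (b ℤ.- c) ≡ a ℤ.* b ℤ.- a ℤ.* c
  distrib = solve-∀

⊛-distribʳ-⊕ : ∀ A B C → (B ⊕ C) ⊛ A ≈ B ⊛ A ⊕ C ⊛ A
⊛-distribʳ-⊕ A B C n ℓ =
  trans (sumTo-cong n λ i _ →
           trans (sumTo-cong ℓ λ j _ → ℤ.*-distribʳ-+ (A (n ∸ i) (ℓ ∸ j)) (B i j) (C i j)) (sumTo-+ ℓ _ _))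
        (sumTo-+ n _ _)

⊛-distribʳ-⊖ : ∀ A B C → (B ⊖ C) ⊛ A ≈ B ⊛ A ⊖ C ⊛ A
⊛-distribʳ-⊖ A B C n ℓ =
  trans (sumTo-cong n λ i _ →
           trans (sumTo-cong ℓ λ j _ → distrib (A (n ∸ i) (ℓ ∸ j)) (B i j) (C i j)) (sumTo-- ℓ _ _))
        (sumTo-- n _ _)
  where
  distrib : ∀ a b c → (b ℤ.- c) ℤ.* a ≡ b ℤ.* a ℤ.- c ℤ.* a
  distrib = solve-∀

⊛-congˡ : ∀ {A A′} B → A ≈ A′ → A ⊛ B ≈ A′ ⊛ B
⊛-congˡ B p n ℓ = sumTo-cong n λ i _ → sumTo-cong ℓ λ j _ → cong (ℤ._* B (n ∸ i) (ℓ ∸ j)) (p i j)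

⊛-congʳ : ∀ A {B B′} → B ≈ B′ → A ⊛ B ≈ A ⊛ B′
⊛-congʳ A p n ℓ = sumTo-cong n λ i _ → sumTo-cong ℓ λ j _ → cong (A i j ℤ.*_) (p (n ∸ i) (ℓ ∸ j))

mono⊛ : ∀ a b E n ℓ →
  (mono a b ⊛ E) n ℓ ≡ (if a ≤ᵇ n then (if b ≤ᵇ ℓ then E (n ∸ a) (ℓ ∸ b) else 0ℤ) else 0ℤ)
mono⊛ a b E n ℓ = begin
  sumTo n (λ i → sumTo ℓ (λ j → mono a b i j ℤ.* E (n ∸ i) (ℓ ∸ j)))
    ≡⟨ sumTo-cong n (λ i _ → trans (sumTo-cong ℓ λ j _ → select (a ≡ᵇ i) (b ≡ᵇ j) _) (sumTo-if ℓ (a ≡ᵇ i) _)) ⟩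
  sumTo n (λ i → if a ≡ᵇ i then sumTo ℓ (λ j → if b ≡ᵇ j then E (n ∸ i) (ℓ ∸ j) else 0ℤ) else 0ℤ)
    ≡⟨ sumTo-single n a _ ⟩
  (if a ≤ᵇ n then sumTo ℓ (λ j → if b ≡ᵇ j then E (n ∸ a) (ℓ ∸ j) else 0ℤ) else 0ℤ)
    ≡⟨ cong (if a ≤ᵇ n then_else 0ℤ) (sumTo-single ℓ b _) ⟩
  (if a ≤ᵇ n then (if b ≤ᵇ ℓ then E (n ∸ a) (ℓ ∸ b) else 0ℤ) else 0ℤ) ∎
  where
  open ≡-Reasoning
  select : ∀ c d e → (if c ∧ d then 1ℤ else 0ℤ) ℤ.* e ≡ (if c then (if d then e else 0ℤ) else 0ℤ)
  select true true e = ℤ.*-identityˡ e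
  select true false e = ℤ.*-zeroˡ e
  select false d e = ℤ.*-zeroˡ e
  sumTo-if : ∀ ℓ c (g : ℕ → ℤ) → sumTo ℓ (λ j → if c then g j else 0ℤ) ≡ (if c then sumTo ℓ g else 0ℤ)
  sumTo-if ℓ true g = refl
  sumTo-if ℓ false g = sumTo-zero ℓ (λ _ _ → refl)

𝟙⊛ : ∀ E → 𝟙 ⊛ E ≈ E
𝟙⊛ E = mono⊛ 0 0 E

X⊛ : ∀ E → X ⊛ E ≈ x· E
X⊛ E zero = mono⊛ 1 0 E zero
X⊛ E (suc n) = mono⊛ 1 0 E (suc n)

XQ⊛ : ∀ E → (X ⊛ Q) ⊛ E ≈ x· q· E
XQ⊛ E = ≈-trans (⊛-congˡ E XQ≈mono) (mono11⊛ E)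
  where
  XQ≈mono : X ⊛ Q ≈ mono 1 1
  XQ≈mono n ℓ = trans (X⊛ Q n ℓ) (x·Q n ℓ)
    where
    x·Q : x· Q ≈ mono 1 1
    x·Q zero ℓ = refl
    x·Q (suc n) ℓ = refl
  mono11⊛ : ∀ E → mono 1 1 ⊛ E ≈ x· q· E
  mono11⊛ E zero ℓ = mono⊛ 1 1 E zero ℓ
  mono11⊛ E (suc n) zero = mono⊛ 1 1 E (suc n) zero
  mono11⊛ E (suc n) (suc ℓ) = mono⊛ 1 1 E (suc n) (suc ℓ)

P⊛ : ∀ E → (𝟙 ⊕ X ⊖ X ⊛ Q) ⊛ E ≈ P· E
P⊛ E = begin
  (𝟙 ⊕ X ⊖ X ⊛ Q) ⊛ E               ≈⟨ ⊛-distribʳ-⊖ E (𝟙 ⊕ X) (X ⊛ Q) ⟩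
  (𝟙 ⊕ X) ⊛ E ⊖ (X ⊛ Q) ⊛ E         ≈⟨ ⊖-cong (⊛-distribʳ-⊕ E 𝟙 X) (XQ⊛ E) ⟩
  𝟙 ⊛ E ⊕ X ⊛ E ⊖ x· q· E           ≈⟨ ⊖-cong (⊕-cong (𝟙⊛ E) (X⊛ E)) ≈-refl ⟩
  P· E                               ∎
  where open ≈-Reasoning

⊛-x·ʳ : ∀ A E → A ⊛ x· E ≈ x· (A ⊛ E)
⊛-x·ʳ A E zero ℓ = sumTo-zero ℓ (λ j _ → ℤ.*-zeroʳ (A 0 j))
⊛-x·ʳ A E (suc n) ℓ = begin
  sumTo n (λ i → sumTo ℓ (λ j → A i j ℤ.* (x· E) (suc n ∸ i) (ℓ ∸ j)))
    ℤ.+ sumTo ℓ (λ j → A (suc n) j ℤ.* (x· E) (n ∸ n) (ℓ ∸ j))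
      ≡⟨ cong₂ ℤ._+_
           (sumTo-cong n λ i i≤n → sumTo-cong ℓ λ j _ → cong (λ m → A i j ℤ.* (x· E) m (ℓ ∸ j)) (+-∸-assoc 1 i≤n))
           (sumTo-zero ℓ λ j _ →
              trans (cong (λ m → A (suc n) j ℤ.* (x· E) m (ℓ ∸ j)) (n∸n≡0 n)) (ℤ.*-zeroʳ (A (suc n) j))) ⟩
  (A ⊛ E) n ℓ ℤ.+ 0ℤ
      ≡⟨ ℤ.+-identityʳ _ ⟩
  (A ⊛ E) n ℓ ∎
  where open ≡-Reasoning

⊛-q·ʳ : ∀ A E → A ⊛ q· E ≈ q· (A ⊛ E)
⊛-q·ʳ A E n zero = sumTo-zero n (λ i _ → ℤ.*-zeroʳ (A i 0))
⊛-q·ʳ A E n (suc ℓ) = sumTo-cong n λ i _ → begin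
  sumTo ℓ (λ j → A i j ℤ.* (q· E) (n ∸ i) (suc ℓ ∸ j)) ℤ.+ A i (suc ℓ) ℤ.* (q· E) (n ∸ i) (ℓ ∸ ℓ)
      ≡⟨ cong₂ ℤ._+_ (sumTo-cong ℓ λ j j≤ℓ → cong (λ m → A i j ℤ.* (q· E) (n ∸ i) m) (+-∸-assoc 1 j≤ℓ))
                     (trans (cong (λ m → A i (suc ℓ) ℤ.* (q· E) (n ∸ i) m) (n∸n≡0 ℓ)) (ℤ.*-zeroʳ (A i (suc ℓ)))) ⟩
  sumTo ℓ (λ j → A i j ℤ.* E (n ∸ i) (ℓ ∸ j)) ℤ.+ 0ℤ
      ≡⟨ ℤ.+-identityʳ _ ⟩
  sumTo ℓ (λ j → A i j ℤ.* E (n ∸ i) (ℓ ∸ j)) ∎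
  where open ≡-Reasoning

𝟙-off : ∀ m k → m ≢ 0 ⊎ k ≢ 0 → 𝟙 m k ≡ 0ℤ
𝟙-off zero zero (inj₁ m≢0) = ⊥-elim (m≢0 refl)
𝟙-off zero zero (inj₂ k≢0) = ⊥-elim (k≢0 refl)
𝟙-off zero (suc k) _ = refl
𝟙-off (suc m) k _ = refl

⊛-identityʳ : ∀ A → A ⊛ 𝟙 ≈ A
⊛-identityʳ A n ℓ = begin
  sumTo n (λ i → sumTo ℓ (λ j → A i j ℤ.* 𝟙 (n ∸ i) (ℓ ∸ j)))
    ≡⟨ sumTo-last n _ (λ i i<n → sumTo-zero ℓ λ j _ →
         trans (cong (A i j ℤ.*_) (𝟙-off (n ∸ i) (ℓ ∸ j) (inj₁ (m>n⇒m∸n≢0 i<n)))) (ℤ.*-zeroʳ (A i j))) ⟩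
  sumTo ℓ (λ j → A n j ℤ.* 𝟙 (n ∸ n) (ℓ ∸ j))
    ≡⟨ sumTo-last ℓ _ (λ j j<ℓ →
         trans (cong (A n j ℤ.*_) (𝟙-off (n ∸ n) (ℓ ∸ j) (inj₂ (m>n⇒m∸n≢0 j<ℓ)))) (ℤ.*-zeroʳ (A n j))) ⟩
  A n ℓ ℤ.* 𝟙 (n ∸ n) (ℓ ∸ ℓ)
    ≡⟨ cong₂ (λ a b → A n ℓ ℤ.* 𝟙 a b) (n∸n≡0 n) (n∸n≡0 ℓ) ⟩
  A n ℓ ℤ.* 1ℤ
    ≡⟨ ℤ.*-identityʳ _ ⟩
  A n ℓ ∎
  where open ≡-Reasoning

⊛-P·ʳ : ∀ A E → A ⊛ P· E ≈ P· (A ⊛ E)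
⊛-P·ʳ A E = begin
  A ⊛ (E ⊕ x· E ⊖ x· q· E)            ≈⟨ ⊛-distribˡ-⊖ A (E ⊕ x· E) (x· q· E) ⟩
  A ⊛ (E ⊕ x· E) ⊖ A ⊛ x· q· E        ≈⟨ ⊖-cong (⊛-distribˡ-⊕ A E (x· E)) (⊛-x·ʳ A (q· E)) ⟩
  A ⊛ E ⊕ A ⊛ x· E ⊖ x· (A ⊛ q· E)    ≈⟨ ⊖-cong (⊕-cong (≈-refl {A ⊛ E}) (⊛-x·ʳ A E)) (x·-cong (⊛-q·ʳ A E)) ⟩
  P· (A ⊛ E)                           ∎
  where open ≈-Reasoning

ChebyshevRecurrence : (ℕ → Series) → Set
ChebyshevRecurrence Y = ∀ k → Y (suc (suc k)) ≈ P· Y (suc k) ⊖ x· Y k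

Chebyshev-recurrence : ChebyshevRecurrence Chebyshev
Chebyshev-recurrence k = ⊖-cong (P⊛ (Chebyshev (suc k))) (X⊛ (Chebyshev k))

-- P· and x· commute, so the recurrence passes to Y (1 + k) - x Y k.
ChebyshevRecurrence-difference : ∀ {Y} → ChebyshevRecurrence Y → ChebyshevRecurrence (λ k → Y (suc k) ⊖ x· Y k)
ChebyshevRecurrence-difference {Y} rec k = begin
  Y (3 + k) ⊖ x· Y (2 + k)
    ≈⟨ ⊖-cong (rec (suc k)) (x·-cong (rec k)) ⟩
  (P· Y (2 + k) ⊖ x· Y (1 + k)) ⊖ x· (P· Y (1 + k) ⊖ x· Y k)
    ≈⟨ ⊖-cong (≈-refl {P· Y (2 + k) ⊖ x· Y (1 + k)}) (x·-⊖ (P· Y (1 + k)) (x· Y k)) ⟩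
  (P· Y (2 + k) ⊖ x· Y (1 + k)) ⊖ (x· P· Y (1 + k) ⊖ x· x· Y k)
    ≈⟨ (λ n ℓ → swap-middle (P· Y (2 + k)) (x· Y (1 + k)) (x· P· Y (1 + k)) (x· x· Y k) n ℓ) ⟩
  (P· Y (2 + k) ⊖ x· P· Y (1 + k)) ⊖ (x· Y (1 + k) ⊖ x· x· Y k)
    ≈⟨ ⊖-cong (⊖-cong (≈-refl {P· Y (2 + k)}) (P·x· (Y (1 + k)))) (x·-⊖ (Y (1 + k)) (x· Y k)) ⟨
  (P· Y (2 + k) ⊖ P· x· Y (1 + k)) ⊖ x· (Y (1 + k) ⊖ x· Y k)
    ≈⟨ ⊖-cong (P·-⊖ (Y (2 + k)) (x· Y (1 + k))) (≈-refl {x· (Y (1 + k) ⊖ x· Y k)}) ⟨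
  P· (Y (2 + k) ⊖ x· Y (1 + k)) ⊖ x· (Y (1 + k) ⊖ x· Y k) ∎
  where
  open ≈-Reasoning
  swap-middle : ∀ A B C E → (A ⊖ B) ⊖ (C ⊖ E) ≈ (A ⊖ C) ⊖ (B ⊖ E)
  swap-middle A B C E n ℓ = identity (A n ℓ) (B n ℓ) (C n ℓ) (E n ℓ)
    where
    identity : ∀ a b c e → (a ℤ.- b) ℤ.- (c ℤ.- e) ≡ (a ℤ.- c) ℤ.- (b ℤ.- e)
    identity = solve-∀

-- D k = x (√x)^(k-1) (U_(k-1)(t) - √x U_(k-2)(t)), so the theorem reads F_(m) · D m = D (m - 1).
D : ℕ → Series
D k = Chebyshev (suc k) ⊖ X ⊛ Chebyshev k

D≈difference : ∀ k → D k ≈ Chebyshev (suc k) ⊖ x· Chebyshev k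
D≈difference k = ⊖-cong (≈-refl {Chebyshev (suc k)}) (X⊛ (Chebyshev k))

D-recurrence : ChebyshevRecurrence D
D-recurrence k = begin
  D (2 + k)                                    ≈⟨ D≈difference (2 + k) ⟩
  Chebyshev (3 + k) ⊖ x· Chebyshev (2 + k)     ≈⟨ ChebyshevRecurrence-difference {Chebyshev} Chebyshev-recurrence k ⟩
  P· (Chebyshev (2 + k) ⊖ x· Chebyshev (1 + k)) ⊖ x· (Chebyshev (1 + k) ⊖ x· Chebyshev k)
                                               ≈⟨ ⊖-cong (P·-cong (D≈difference (1 + k))) (x·-cong (D≈difference k)) ⟨
  P· D (1 + k) ⊖ x· D k                        ∎
  where open ≈-Reasoning

D₀ : D 0 ≈ x· 𝟙
D₀ n ℓ = trans (D≈difference 0 n ℓ) (pointwise n)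
  where
  identity : ∀ a → 0ℤ ℤ.- ℤ.- a ≡ a
  identity = solve-∀
  pointwise : ∀ n → (Chebyshev 1 ⊖ x· Chebyshev 0) n ℓ ≡ (x· 𝟙) n ℓ
  pointwise zero = refl
  pointwise (suc n) = identity (𝟙 n ℓ)

D₁ : D 1 ≈ x· 𝟙
D₁ n ℓ =
  trans (D≈difference 1 n ℓ) (trans (cong (λ t → t ℤ.- (x· Chebyshev 1) n ℓ) (Chebyshev-recurrence 0 n ℓ)) (pointwise n ℓ))
  where
  identity : ∀ a → 0ℤ ℤ.+ 0ℤ ℤ.- 0ℤ ℤ.- ℤ.- a ℤ.- 0ℤ ≡ a
  identity = solve-∀
  pointwise : ∀ n ℓ → (P· Chebyshev 1 ⊖ x· Chebyshev 0 ⊖ x· Chebyshev 1) n ℓ ≡ (x· 𝟙) n ℓ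
  pointwise zero ℓ = refl
  pointwise (suc n) zero = identity (𝟙 n zero)
  pointwise (suc n) (suc ℓ) = identity (𝟙 n (suc ℓ))

-- Solving the recurrence

-- The series atLeast r and exactly r count the permutations of F_(m), m = B + 1,
-- whose final decreasing run has length at least r, resp. exactly r.
record RunDecomposition (B : ℕ) (T : Series) : Set where
  field
    atLeast exactly : ℕ → Series
    T≈atLeast₀ : T ≈ atLeast 0
    atLeast-split : ∀ r → atLeast r ≈ exactly r ⊕ atLeast (suc r)
    atLeast-vanishes : atLeast (suc B) ≈ 𝟘
    exactly₀ : exactly 0 ≈ 𝟙
    exactly₁ : 0 < B → exactly 1 ≈ x· q· atLeast 0
    exactly-recurrence : ∀ k → 2 + k ≤ B → exactly (2 + k) ≈ x· q· atLeast (2 + k) ⊕ x· exactly (1 + k)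

subtract-left : ∀ {A B C} → A ≈ B ⊕ C → C ≈ A ⊖ B
subtract-left {A} {B} {C} A≈B⊕C n ℓ = trans (identity (B n ℓ) (C n ℓ)) (cong (λ t → t ℤ.- B n ℓ) (sym (A≈B⊕C n ℓ)))
  where
  identity : ∀ b c → c ≡ b ℤ.+ c ℤ.- b
  identity = solve-∀

P·x·-combine : ∀ A A′ E₁ E₀ → P· (x· A ⊕ E₁) ⊖ x· (x· A′ ⊕ E₀) ≈ x· (P· A ⊖ x· A′) ⊕ (P· E₁ ⊖ x· E₀)
P·x·-combine A A′ E₁ E₀ = begin
  P· (x· A ⊕ E₁) ⊖ x· (x· A′ ⊕ E₀)          ≈⟨ ⊖-cong (P·-⊕ (x· A) E₁) (x·-⊕ (x· A′) E₀) ⟩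
  (P· x· A ⊕ P· E₁) ⊖ (x· x· A′ ⊕ x· E₀)    ≈⟨ ⊖-cong (⊕-cong (P·x· A) (≈-refl {P· E₁})) (≈-refl {x· x· A′ ⊕ x· E₀}) ⟩
  (x· P· A ⊕ P· E₁) ⊖ (x· x· A′ ⊕ x· E₀)    ≈⟨ (λ n ℓ → identity ((x· P· A) n ℓ) ((P· E₁) n ℓ) ((x· x· A′) n ℓ) ((x· E₀) n ℓ)) ⟩
  (x· P· A ⊖ x· x· A′) ⊕ (P· E₁ ⊖ x· E₀)    ≈⟨ ⊕-cong (x·-⊖ (P· A) (x· A′)) (≈-refl {P· E₁ ⊖ x· E₀}) ⟨
  x· (P· A ⊖ x· A′) ⊕ (P· E₁ ⊖ x· E₀)       ∎
  where
  open ≈-Reasoning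
  identity : ∀ a b c e → a ℤ.+ b ℤ.- (c ℤ.+ e) ≡ a ℤ.- c ℤ.+ (b ℤ.- e)
  identity = solve-∀

module _ {B T} (R : RunDecomposition B T) where
  open RunDecomposition R
  open ≈-Reasoning

  T⊛D-recurrence : ChebyshevRecurrence (λ k → T ⊛ D k)
  T⊛D-recurrence k = begin
    T ⊛ D (2 + k)                             ≈⟨ ⊛-congʳ T (D-recurrence k) ⟩
    T ⊛ (P· D (1 + k) ⊖ x· D k)               ≈⟨ ⊛-distribˡ-⊖ T (P· D (1 + k)) (x· D k) ⟩
    T ⊛ P· D (1 + k) ⊖ T ⊛ x· D k             ≈⟨ ⊖-cong (⊛-P·ʳ T (D (1 + k))) (⊛-x·ʳ T (D k)) ⟩
    P· (T ⊛ D (1 + k)) ⊖ x· (T ⊛ D k)         ∎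

  T⊛x·𝟙 : T ⊛ x· 𝟙 ≈ x· atLeast 0
  T⊛x·𝟙 = ≈-trans (⊛-x·ʳ T 𝟙) (x·-cong (≈-trans (⊛-identityʳ T) T≈atLeast₀))

  Invariant : ℕ → Set
  Invariant k = T ⊛ D (suc k) ≈ x· atLeast (suc k) ⊕ D k

  atLeast₀ : atLeast 0 ≈ 𝟙 ⊕ atLeast 1
  atLeast₀ = ≈-trans (atLeast-split 0) (⊕-cong exactly₀ (≈-refl {atLeast 1}))

  invariant₀ : Invariant 0
  invariant₀ = begin
    T ⊛ D 1                   ≈⟨ ⊛-congʳ T D₁ ⟩
    T ⊛ x· 𝟙                  ≈⟨ T⊛x·𝟙 ⟩
    x· atLeast 0              ≈⟨ x·-cong atLeast₀ ⟩
    x· (𝟙 ⊕ atLeast 1)        ≈⟨ x·-⊕ 𝟙 (atLeast 1) ⟩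
    x· 𝟙 ⊕ x· atLeast 1       ≈⟨ (λ n ℓ → ℤ.+-comm ((x· 𝟙) n ℓ) ((x· atLeast 1) n ℓ)) ⟩
    x· atLeast 1 ⊕ x· 𝟙       ≈⟨ ⊕-cong (≈-refl {x· atLeast 1}) D₀ ⟨
    x· atLeast 1 ⊕ D 0        ∎

  invariant₁ : 0 < B → Invariant 1
  invariant₁ 0<B = begin
    T ⊛ D 2                                       ≈⟨ T⊛D-recurrence 0 ⟩
    P· (T ⊛ D 1) ⊖ x· (T ⊛ D 0)                   ≈⟨ ⊖-cong (P·-cong (≈-trans (⊛-congʳ T D₁) T⊛x·𝟙))
                                                            (x·-cong (≈-trans (⊛-congʳ T D₀) T⊛x·𝟙)) ⟩
    P· x· atLeast 0 ⊖ x· x· atLeast 0             ≈⟨ ⊖-cong (P·x· (atLeast 0)) (≈-refl {x· x· atLeast 0}) ⟩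
    x· P· atLeast 0 ⊖ x· x· atLeast 0             ≈⟨ x·-⊖ (P· atLeast 0) (x· atLeast 0) ⟨
    x· (P· atLeast 0 ⊖ x· atLeast 0)              ≈⟨ x·-cong tail ⟩
    x· (atLeast 2 ⊕ 𝟙)                            ≈⟨ x·-⊕ (atLeast 2) 𝟙 ⟩
    x· atLeast 2 ⊕ x· 𝟙                           ≈⟨ ⊕-cong (≈-refl {x· atLeast 2}) D₁ ⟨
    x· atLeast 2 ⊕ D 1                            ∎
    where
    tail : P· atLeast 0 ⊖ x· atLeast 0 ≈ atLeast 2 ⊕ 𝟙
    tail = begin
      P· atLeast 0 ⊖ x· atLeast 0                 ≈⟨ (λ n ℓ → identity (atLeast 0 n ℓ) ((x· atLeast 0) n ℓ) ((x· q· atLeast 0) n ℓ)) ⟩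
      atLeast 0 ⊖ x· q· atLeast 0                 ≈⟨ ⊖-cong (≈-trans atLeast₀ (⊕-cong (≈-refl {𝟙}) (atLeast-split 1))) (≈-sym (exactly₁ 0<B)) ⟩
      𝟙 ⊕ (exactly 1 ⊕ atLeast 2) ⊖ exactly 1     ≈⟨ (λ n ℓ → identity′ (𝟙 n ℓ) (exactly 1 n ℓ) (atLeast 2 n ℓ)) ⟩
      atLeast 2 ⊕ 𝟙                               ∎
      where
      identity : ∀ a b c → a ℤ.+ b ℤ.- c ℤ.- b ≡ a ℤ.- c
      identity = solve-∀
      identity′ : ∀ a b c → a ℤ.+ (b ℤ.+ c) ℤ.- b ≡ c ℤ.+ a
      identity′ = solve-∀

  invariant-step : ∀ k → 2 + k ≤ B → Invariant k → Invariant (1 + k) → Invariant (2 + k)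
  invariant-step k 2+k≤B inv₀ inv₁ = begin
    T ⊛ D (3 + k)                                                 ≈⟨ T⊛D-recurrence (1 + k) ⟩
    P· (T ⊛ D (2 + k)) ⊖ x· (T ⊛ D (1 + k))                       ≈⟨ ⊖-cong (P·-cong inv₁) (x·-cong inv₀) ⟩
    P· (x· atLeast (2 + k) ⊕ D (1 + k)) ⊖ x· (x· atLeast (1 + k) ⊕ D k)
                                                                  ≈⟨ P·x·-combine (atLeast (2 + k)) (atLeast (1 + k)) (D (1 + k)) (D k) ⟩
    x· (P· atLeast (2 + k) ⊖ x· atLeast (1 + k)) ⊕ (P· D (1 + k) ⊖ x· D k)
                                                                  ≈⟨ ⊕-cong (x·-cong tail) (≈-sym (D-recurrence k)) ⟩
    x· atLeast (3 + k) ⊕ D (2 + k)                                ∎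
    where
    tail : P· atLeast (2 + k) ⊖ x· atLeast (1 + k) ≈ atLeast (3 + k)
    tail = begin
      P· atLeast (2 + k) ⊖ x· atLeast (1 + k)
        ≈⟨ ⊖-cong (≈-refl {P· atLeast (2 + k)}) (≈-trans (x·-cong (atLeast-split (1 + k))) (x·-⊕ (exactly (1 + k)) (atLeast (2 + k)))) ⟩
      P· atLeast (2 + k) ⊖ (x· exactly (1 + k) ⊕ x· atLeast (2 + k))
        ≈⟨ (λ n ℓ → identity (atLeast (2 + k) n ℓ) ((x· atLeast (2 + k)) n ℓ) ((x· q· atLeast (2 + k)) n ℓ) ((x· exactly (1 + k)) n ℓ)) ⟩
      atLeast (2 + k) ⊖ (x· q· atLeast (2 + k) ⊕ x· exactly (1 + k))
        ≈⟨ ⊖-cong (≈-refl {atLeast (2 + k)}) (exactly-recurrence k 2+k≤B) ⟨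
      atLeast (2 + k) ⊖ exactly (2 + k)
        ≈⟨ subtract-left (atLeast-split (2 + k)) ⟨
      atLeast (3 + k) ∎
      where
      identity : ∀ a b c e → a ℤ.+ b ℤ.- c ℤ.- (e ℤ.+ b) ≡ a ℤ.- (c ℤ.+ e)
      identity = solve-∀

  invariant : ∀ k → k ≤ B → Invariant k
  invariant zero _ = invariant₀
  invariant (suc zero) 1≤B = invariant₁ 1≤B
  invariant (suc (suc k)) 2+k≤B =
    invariant-step k 2+k≤B (invariant k (≤-trans (n≤1+n k) 1+k≤B)) (invariant (suc k) 1+k≤B)
    where
    1+k≤B : 1 + k ≤ B
    1+k≤B = ≤-trans (n≤1+n (suc k)) 2+k≤B

  T⊛D≈D : T ⊛ D (suc B) ≈ D B
  T⊛D≈D = begin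
    T ⊛ D (suc B)                ≈⟨ invariant B ≤-refl ⟩
    x· atLeast (suc B) ⊕ D B     ≈⟨ ⊕-cong (≈-trans (x·-cong atLeast-vanishes) x·𝟘) (≈-refl {D B}) ⟩
    𝟘 ⊕ D B                      ≈⟨ (λ n ℓ → ℤ.+-identityˡ (D B n ℓ)) ⟩
    D B                          ∎

-- The decomposition by final runs

tally : (List ℕ → Bool) → Series
tally p n ℓ = ℤ.+ count (λ σ → p σ ∧ (lis σ ≡ᵇ ℓ)) (perms n)

tally-lis+1 : ∀ p n ℓ → ℤ.+ count (λ σ → p σ ∧ (suc (lis σ) ≡ᵇ ℓ)) (perms n) ≡ (q· tally p) n ℓ
tally-lis+1 p n zero = cong ℤ.+_ (count-zero (All.universal (λ σ → ∧-zeroʳ (p σ)) (perms n)))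
tally-lis+1 p n (suc ℓ) = refl

indicator-run-split : ∀ g r f e →
  indicator ((g ∧ (r ≤ᵇ f)) ∧ e) ≡ indicator ((g ∧ (f ≡ᵇ r)) ∧ e) + indicator ((g ∧ (suc r ≤ᵇ f)) ∧ e)
indicator-run-split false r f e = refl
indicator-run-split true r f e with <-cmp f r
... | tri< f<r _ _ rewrite ≤ᵇ-false f<r | ≡ᵇ-false (<⇒≢ f<r) | ≤ᵇ-false (m<n⇒m<1+n f<r) = refl
... | tri≈ _ refl _ rewrite ≤ᵇ-true (≤-refl {f}) | ≡ᵇ-refl f | ≤ᵇ-false (n<1+n f) = sym (+-identityʳ _)
... | tri> _ _ r<f rewrite ≤ᵇ-true (<⇒≤ r<f) | ≡ᵇ-false (>⇒≢ r<f) | ≤ᵇ-true r<f = refl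

indicator-gain-split : ∀ g k f l ℓ →
  indicator ((g ∧ (suc k ≤ᵇ f)) ∧ (l + lisGain (suc k) f ≡ᵇ ℓ))
    ≡ indicator ((g ∧ (suc (suc k) ≤ᵇ f)) ∧ (suc l ≡ᵇ ℓ)) + indicator ((g ∧ (f ≡ᵇ suc k)) ∧ (l ≡ᵇ ℓ))
indicator-gain-split false k f l ℓ = refl
indicator-gain-split true k zero l ℓ = refl
indicator-gain-split true k (suc f) l ℓ with <-cmp f k
... | tri< f<k _ _ rewrite <ᵇ-false {k} {suc f} f<k | <ᵇ-false {k} {f} (<⇒≤ f<k) | ≡ᵇ-false {f} {k} (<⇒≢ f<k) = refl
... | tri≈ _ refl _ rewrite <ᵇ-true (n<1+n f) | <ᵇ-false {f} {f} ≤-refl | ≡ᵇ-refl f | +-identityʳ l = refl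
... | tri> _ _ k<f rewrite <ᵇ-true (m<n⇒m<1+n k<f) | <ᵇ-true k<f | ≡ᵇ-false {f} {k} (>⇒≢ k<f) | +-comm l 1 = sym (+-identityʳ _)

module _ (B : ℕ) where

  F≈tally-runFrom₀ : F (decreasing (suc B)) ≈ tally (goodWithRunFrom B 0)
  F≈tally-runFrom₀ n ℓ = cong ℤ.+_ (trans (length-filter≡count _ (perms n)) (count-ext reassociate (perms n)))
    where
    reassociate : ∀ σ → avoids σ p312 ∧ avoids σ (decreasing (suc B)) ∧ (lis σ ≡ᵇ ℓ)
                        ≡ goodWithRunFrom B 0 σ ∧ (lis σ ≡ᵇ ℓ)
    reassociate σ = trans (sym (∧-assoc (avoids σ p312) _ _)) (cong (_∧ (lis σ ≡ᵇ ℓ)) (sym (∧-identityʳ (good B σ))))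

  tally-runFrom-split : ∀ r → tally (goodWithRunFrom B r) ≈ tally (goodWithRun B r) ⊕ tally (goodWithRunFrom B (suc r))
  tally-runFrom-split r n ℓ =
    trans (cong ℤ.+_ (count-+ (λ σ → goodWithRun B r σ ∧ (lis σ ≡ᵇ ℓ)) (λ σ → goodWithRunFrom B (suc r) σ ∧ (lis σ ≡ᵇ ℓ))
                              (perms n) (λ σ → indicator-run-split (good B σ) r (finalRun σ) (lis σ ≡ᵇ ℓ))))
          (ℤ.pos-+ (count _ (perms n)) (count _ (perms n)))

  tally-runFrom-beyond : tally (goodWithRunFrom B (suc B)) ≈ 𝟘
  tally-runFrom-beyond n ℓ = cong ℤ.+_ (count-zero (All.universal beyond (perms n)))
    where
    beyond : ∀ σ → goodWithRunFrom B (suc B) σ ∧ (lis σ ≡ᵇ ℓ) ≡ false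
    beyond σ with good B σ in g
    ... | false = refl
    ... | true rewrite ≤ᵇ-false (s≤s (finalRun-bound B σ (proj₂ (∧-true⁻ {avoids σ p312} g)))) = refl

  tally-run₀ : tally (goodWithRun B 0) ≈ 𝟙
  tally-run₀ zero zero = refl
  tally-run₀ zero (suc ℓ) = refl
  tally-run₀ (suc n) ℓ = cong ℤ.+_ (count-zero (All-perms-insertion n nonempty))
    where
    nonempty : ∀ xs ys → IsPerm n (xs ++ ys) → goodWithRun B 0 (xs ++ suc n ∷ ys) ∧ (lis (xs ++ suc n ∷ ys) ≡ᵇ ℓ) ≡ false
    nonempty xs ys _ rewrite ≡ᵇ-false (>⇒≢ (finalRun-insert-pos xs (suc n) ys)) | ∧-zeroʳ (good B (xs ++ suc n ∷ ys)) = refl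

  tally-run₁ : 0 < B → tally (goodWithRun B 1) ≈ x· q· tally (goodWithRunFrom B 0)
  tally-run₁ 0<B zero ℓ = refl
  tally-run₁ 0<B (suc n) ℓ =
    trans (cong ℤ.+_ (trans (count-perms-suc B 0 ℓ n 0<B) (count-ext gain-one (perms n)))) (tally-lis+1 _ n ℓ)
    where
    gain-one : ∀ π → goodWithRunFrom B 0 π ∧ (lis π + lisGain 0 (finalRun π) ≡ᵇ ℓ)
                     ≡ goodWithRunFrom B 0 π ∧ (suc (lis π) ≡ᵇ ℓ)
    gain-one π rewrite lisGain-0 (finalRun π) | +-comm (lis π) 1 = refl

  tally-run-recurrence : ∀ k → 2 + k ≤ B →
    tally (goodWithRun B (2 + k)) ≈ x· q· tally (goodWithRunFrom B (2 + k)) ⊕ x· tally (goodWithRun B (1 + k))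
  tally-run-recurrence k 2+k≤B zero ℓ = refl
  tally-run-recurrence k 2+k≤B (suc n) ℓ = begin
    ℤ.+ count (λ σ → goodWithRun B (2 + k) σ ∧ (lis σ ≡ᵇ ℓ)) (perms (suc n))
      ≡⟨ cong ℤ.+_ (count-perms-suc B (suc k) ℓ n 2+k≤B) ⟩
    ℤ.+ count (λ π → goodWithRunFrom B (1 + k) π ∧ (lis π + lisGain (1 + k) (finalRun π) ≡ᵇ ℓ)) (perms n)
      ≡⟨ cong ℤ.+_ (count-+ (λ π → goodWithRunFrom B (2 + k) π ∧ (suc (lis π) ≡ᵇ ℓ)) (λ π → goodWithRun B (1 + k) π ∧ (lis π ≡ᵇ ℓ))
                            (perms n) (λ π → indicator-gain-split (good B π) k (finalRun π) (lis π) ℓ)) ⟩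
    ℤ.+ (count (λ π → goodWithRunFrom B (2 + k) π ∧ (suc (lis π) ≡ᵇ ℓ)) (perms n)
         + count (λ π → goodWithRun B (1 + k) π ∧ (lis π ≡ᵇ ℓ)) (perms n))
      ≡⟨ ℤ.pos-+ (count _ (perms n)) (count _ (perms n)) ⟩
    ℤ.+ count (λ π → goodWithRunFrom B (2 + k) π ∧ (suc (lis π) ≡ᵇ ℓ)) (perms n) ℤ.+ tally (goodWithRun B (1 + k)) n ℓ
      ≡⟨ cong (λ t → t ℤ.+ tally (goodWithRun B (1 + k)) n ℓ) (tally-lis+1 _ n ℓ) ⟩
    (q· tally (goodWithRunFrom B (2 + k))) n ℓ ℤ.+ tally (goodWithRun B (1 + k)) n ℓ ∎
    where open ≡-Reasoning

  runDecomposition : RunDecomposition B (F (decreasing (suc B)))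
  runDecomposition = record
    { atLeast = λ r → tally (goodWithRunFrom B r)
    ; exactly = λ r → tally (goodWithRun B r)
    ; T≈atLeast₀ = F≈tally-runFrom₀
    ; atLeast-split = tally-runFrom-split
    ; atLeast-vanishes = tally-runFrom-beyond
    ; exactly₀ = tally-run₀
    ; exactly₁ = tally-run₁
    ; exactly-recurrence = tally-run-recurrence
    }

corollary3p3 : (n a b : ℕ) →
    (F (decreasing (suc n)) ⊛ (Chebyshev (suc (suc n)) ⊖ X ⊛ Chebyshev (suc n))) a b
    ≡ (Chebyshev (suc n) ⊖ X ⊛ Chebyshev n) a b
corollary3p3 n = T⊛D≈D (runDecomposition n)
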